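{- Let $\pi=a_1a_2\cdots a_n\in\mathfrak{S}_n$ ($n\ge 2$) be a separable permutation. Then: (i) If $a_1<a_n$, there is an integer $m$ with $1\le m<n$ such that, writing $\pi=\pi_A\pi_B$ with $\pi_A=a_1\cdots a_m$ and $\pi_B=a_{m+1}\cdots a_n$, $$F(\Lambda_\pi,q)=F(\Lambda_{\pi_A},q)\,F(\Lambda_{\pi_B},q).$$ (ii) If $a_1>a_n$, there is an integer $m$ with $1\le m<n$ such that, writing $\pi=\pi_A\pi_B$ with $\pi_A=a_1\cdots a_m$ and $\pi_B=a_{m+1}\cdots a_n$, $$F(\Lambda_\pi,q)=\begin{bmatrix}n\\ m\end{bmatrix}F(\Lambda_{\pi_A},q)\,F(\Lambda_{\pi_B},q).$$
   Context: $\mathfrak{S}_n$ is the symmetric group on $\{1,\dots,n\}$, permutations written in one-line notation $\pi=a_1\cdots a_n$; products are composed right-to-left. The length $\ell(\pi)=\#\{i<j: a_i>a_j\}$. Let $s_i=(i,i+1)$. The weak (Bruhat) order on $\mathfrak{S}_n$ is generated by cover relations $\pi\lessdot\sigma$ when $\sigma=\pi s_i$ for some $i$ and $\ell(\sigma)>\ell(\pi)$ (i.e. $\sigma$ is obtained from $\pi$ by swapping the entries in positions $i,i+1$ to create an inversion). $\mathrm{id}$ is the identity and $w_0=n(n-1)\cdots 1$. For $\pi\in\mathfrak{S}_n$, $\Lambda_\pi=[\mathrm{id},\pi]$ in weak order and $F(\Lambda_\pi,q)=\sum_{u\in\Lambda_\pi}q^{\ell(u)}$. A permutation is separable if it is 3142-avoiding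 and 2413-avoiding (no $i<j<k<h$ with $a_j<a_h<a_i<a_k$ or $a_k<a_i<a_h<a_j$). For a word $\sigma$ of distinct integers of length $k$, $F(\Lambda_\sigma,q)$ means $F(\Lambda_{\mathrm{st}(\sigma)},q)$, where $\mathrm{st}(\sigma)\in\mathfrak{S}_k$ is obtained by replacing the $j$-th smallest letter by $j$. Notation: $[i]=1+q+\cdots+q^{i-1}$, $[n]!=[1][2]\cdots[n]$, $\begin{bmatrix}n\\ m\end{bmatrix}=\frac{[n]!}{[m]![n-m]!}$. -}

module Defs where

open import Data.Nat using (ℕ; zero; suc; _+_; _*_; _∸_; _<_; _<?_; _≟_)
open import Data.Nat.Properties using () renaming (_≟_ to _≟ℕ_)
open import Data.List using (List; []; _∷_; _++_; map; filter; length; concatMap; deduplicate; applyUpTo; upTo; foldr)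
open import Data.Nat.ListAction using (sum)
import Data.List.Properties as LP
open import Data.List.Relation.Binary.Permutation.Propositional using (_↭_)
open import Data.Product using (∃; _×_; _,_)
open import Data.Sum using (_⊎_)
open import Relation.Nullary using (¬_)
open import Relation.Binary.PropositionalEquality using (_≡_)

-- Permutations in one-line notation, as words (lists) of naturals.

-- entry at 0-based position i (default 0 out of range; only used in range)
at : List ℕ → ℕ → ℕ
at []       _       = 0
at (x ∷ _)  zero    = x
at (_ ∷ xs) (suc i) = at xs i

IsPerm : ℕ → List ℕ → Set
IsPerm n π = π ↭ applyUpTo suc n

-- length ℓ = number of inversions
inv : List ℕ → ℕ
inv []       = 0
inv (x ∷ xs) = length (filter (λ y → y <? x) xs) + inv xs

-- separable: 3142- and 2413-avoiding (positions 0-based, i<j<k<h<length)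
Separable : List ℕ → Set
Separable π = ¬ (∃ λ i → ∃ λ j → ∃ λ k → ∃ λ h →
  i < j × j < k × k < h × h < length π ×
  ((at π j < at π h × at π h < at π i × at π i < at π k)
   ⊎ (at π k < at π i × at π i < at π h × at π h < at π j)))

st : List ℕ → List ℕ
st w = map (λ x → suc (length (filter (λ y → y <? x) w))) w

-- Weak order lower interval.
-- lowerCovers σ = all u with u ⋖ σ, i.e. σ = u s_i, ℓ(σ) > ℓ(u):
-- u is σ with the entries in positions i,i+1 swapped where σ_i > σ_{i+1}.
lowerCovers : List ℕ → List (List ℕ)
lowerCovers []       = []
lowerCovers (x ∷ xs) = go x xs
  where
  swap? : ℕ → List ℕ → List (List ℕ)
  swap? x (y ∷ rest) with y <? x
  ... | Relation.Nullary.yes _ = (y ∷ x ∷ rest) ∷ []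
  ... | Relation.Nullary.no  _ = []
  swap? x [] = []
  go : ℕ → List ℕ → List (List ℕ)
  go x []       = []
  go x (y ∷ ys) = swap? x (y ∷ ys) ++ map (x ∷_) (go y ys)

downFrom : ℕ → List ℕ → List (List ℕ)
downFrom zero     σ = σ ∷ []
downFrom (suc f)  σ = σ ∷ concatMap (downFrom f) (lowerCovers σ)

-- Λ_π = [id, π] (duplicates removed).  Each cover step lowers ℓ by exactly 1,
-- so ℓ(π) steps reach every element below π.
Λ : List ℕ → List (List ℕ)
Λ π = deduplicate (LP.≡-dec _≟ℕ_) (downFrom (inv π) π)

-- Polynomials in q with ℕ coefficients, as coefficient functions.
Poly : Set
Poly = ℕ → ℕ

infix 4 _≈P_
_≈P_ : Poly → Poly → Set
f ≈P g = ∀ k → f k ≡ g k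

infixl 7 _*P_
_*P_ : Poly → Poly → Poly
(f *P g) k = sum (map (λ i → f i * g (k ∸ i)) (upTo (suc k)))

oneP : Poly
oneP zero    = 1
oneP (suc _) = 0

-- [i] = 1 + q + … + q^{i-1}
qint : ℕ → Poly
qint i k with k <? i
... | Relation.Nullary.yes _ = 1
... | Relation.Nullary.no  _ = 0

qfact : ℕ → Poly
qfact zero    = oneP
qfact (suc n) = qfact n *P qint (suc n)

F : List ℕ → Poly
F σ k = length (filter (λ u → inv u ≟ k) (Λ (st σ)))

module Submission where

-- Write A ≪ B when every letter of A is below every letter of B.
-- Direct sums (A ≪ B): the elements below A ++ B are the A′ ++ B′ with A′ ≤ A,
-- B′ ≤ B, and ℓ is additive, so F(A ++ B) = F(A) F(B).  Skew sums (B ≪ A): they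
-- are the shuffles of such A′, B′, with ℓ = ℓ(A′) + ℓ(B′) + ℓ(0/1 profile), so
-- F(A ++ B) = F(A) F(B) G(|A|,|B|).  Applied to w₀, where F = [n]!, this gives
-- [m+r]! = [m]! [r]! G(m,r), which eliminates G.  Finally a separable word of
-- distinct letters splits as a direct or skew sum (delete the maximal letter,
-- split by induction, re-insert; a split that cannot be transported exhibits a
-- 2413 or 3142), and comparing a₁ with aₙ tells which kind of split it is.

open import Defs
open import Level using (0ℓ)
open import Function using (id; _∘_; case_of_)
open import Function.Bundles using (mk⇔)
open import Data.Empty using (⊥; ⊥-elim)
open import Data.Product using (∃; ∃₂; _×_; _,_; proj₁; proj₂)
open import Data.Sum as Sum using (_⊎_; inj₁; inj₂)
open import Relation.Nullary using (¬_; yes; no; Dec)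
open import Relation.Unary using (Decidable)
open import Relation.Binary.Definitions using (tri<; tri≈; tri>)
open import Relation.Binary.Bundles using (Setoid)
open import Relation.Binary.PropositionalEquality
import Relation.Binary.Reasoning.Setoid as SetoidReasoning
open import Relation.Binary.Construct.Closure.ReflexiveTransitive using (Star; ε; _◅_; _◅◅_; gmap)
open import Data.Nat using (ℕ; zero; suc; _+_; _*_; _∸_; _<_; _≤_; _>_; _<?_; _≤?_; _≟_; z≤n; s≤s)
open import Data.Nat.Properties
open import Data.Nat.ListAction using (sum)
open import Data.Nat.Solver using (module +-*-Solver)
open +-*-Solver using (solve; _:+_; _:*_; _:=_; con)
open import Algebra.Properties.CommutativeSemigroup +-commutativeSemigroup using (x∙yz≈y∙xz)
open import Data.List using (List; []; _∷_; _++_; map; filter; length; concatMap; replicate; take; drop; upTo)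
open import Data.List.Properties using (filter-++; length-++; filter-none; filter-all; filter-accept; filter-reject; map-applyUpTo; map-cong; ∷-injectiveˡ; ∷-injectiveʳ; map-++; map-∘; length-replicate; map-injective; ++-cancelˡ; length-map; map-cong-local; filter-notAll; length-take; length-drop; ++-identityʳ; take++drop≡id; length-applyUpTo)
import Data.List.Properties as LP
open import Data.List.Extrema ≤-totalOrder using (max; argmax-sel; ⊥≤max; xs≤max)
open import Data.List.Membership.Propositional using (_∈_; find; lose)
open import Data.List.Membership.Propositional.Properties
  using (∈-∃++; ∈-map⁺; ∈-map⁻; ∈-++⁺ˡ; ∈-++⁺ʳ; ∈-++⁻; ∈-concatMap⁺; ∈-concatMap⁻; ∈-deduplicate⁺; ∈-deduplicate⁻)
open import Data.List.Membership.Propositional.Properties.WithK using (unique∧set⇒bag)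
open import Data.List.Relation.Unary.Any as Any using (here; there)
open import Data.List.Relation.Unary.All as All using (All; []; _∷_)
open import Data.List.Relation.Unary.All.Properties using (All¬⇒¬Any; ¬All⇒Any¬; replicate⁺; ++⁻ˡ; ++⁻ʳ; take⁺; drop⁺)
open import Data.List.Relation.Unary.AllPairs using ([]; _∷_)
open import Data.List.Relation.Unary.Unique.Propositional using (Unique)
import Data.List.Relation.Unary.Unique.Propositional.Properties as UP
open import Data.List.Relation.Unary.Unique.DecPropositional.Properties using (deduplicate-!)
open import Data.List.Relation.Binary.Permutation.Propositional as Perm using (_↭_; ↭-sym; ↭-trans; ↭-refl; ↭⇒↭ₛ)
open import Data.List.Relation.Binary.Permutation.Propositional.Properties using (filter-↭; ↭-length; All-resp-↭) renaming (shift to ↭-shift; ++-comm to ↭-++-comm)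
open import Data.List.Relation.Binary.Permutation.Setoid.Properties (setoid ℕ) using (Unique-resp-↭)
open import Data.List.Relation.Binary.BagAndSetEquality using (∼bag⇒↭)

take-++-length : (L X : List ℕ) → take (length L) (L ++ X) ≡ L
take-++-length []      X = refl
take-++-length (x ∷ L) X = cong (x ∷_) (take-++-length L X)

drop-++-length : (L X : List ℕ) → drop (length L) (L ++ X) ≡ X
drop-++-length []      X = refl
drop-++-length (x ∷ L) X = drop-++-length L X

take-++-≤ : (L X : List ℕ) {m : ℕ} → m ≤ length L → take m (L ++ X) ≡ take m L
take-++-≤ L       X {zero}  _ = refl
take-++-≤ (x ∷ L) X {suc m} p = cong (x ∷_) (take-++-≤ L X (≤-pred p))

drop-++-≤ : (L X : List ℕ) {m : ℕ} → m ≤ length L → drop m (L ++ X) ≡ drop m L ++ X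
drop-++-≤ L       X {zero}  _ = refl
drop-++-≤ (x ∷ L) X {suc m} p = drop-++-≤ L X (≤-pred p)

take-++-+ : (L X : List ℕ) (m : ℕ) → take (length L + m) (L ++ X) ≡ L ++ take m X
take-++-+ []      X m = refl
take-++-+ (x ∷ L) X m = cong (x ∷_) (take-++-+ L X m)

drop-++-+ : (L X : List ℕ) (m : ℕ) → drop (length L + m) (L ++ X) ≡ drop m X
drop-++-+ []      X m = refl
drop-++-+ (x ∷ L) X m = drop-++-+ L X m

count : {P : ℕ → Set} → Decidable P → List ℕ → ℕ
count P? w = length (filter P? w)

count-++ : {P : ℕ → Set} (P? : Decidable P) (u v : List ℕ) →
  count P? (u ++ v) ≡ count P? u + count P? v
count-++ P? u v = trans (cong length (filter-++ P? u v)) (length-++ (filter P? u))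

count-↭ : {P : ℕ → Set} (P? : Decidable P) {u v : List ℕ} → u ↭ v → count P? u ≡ count P? v
count-↭ P? p = ↭-length (filter-↭ P? p)

count-none : {P : ℕ → Set} (P? : Decidable P) {w : List ℕ} → All (λ z → ¬ P z) w → count P? w ≡ 0
count-none P? a = cong length (filter-none P? a)

count-all : {P : ℕ → Set} (P? : Decidable P) {w : List ℕ} → All P w → count P? w ≡ length w
count-all P? a = cong length (filter-all P? a)

data Cover : List ℕ → List ℕ → Set where
  swap-descent : ∀ {x y s} → y < x → Cover (x ∷ y ∷ s) (y ∷ x ∷ s)
  under        : ∀ {x w u} → Cover w u → Cover (x ∷ w) (x ∷ u)

-- Below w u : u ≤ w in weak order (reflexive-transitive closure of covers).
Below : List ℕ → List ℕ → Set
Below = Star Cover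

cover⇒↭ : ∀ {w u} → Cover w u → w ↭ u
cover⇒↭ (swap-descent _) = Perm.swap _ _ ↭-refl
cover⇒↭ (under c)        = Perm.prep _ (cover⇒↭ c)

below⇒↭ : ∀ {w u} → Below w u → w ↭ u
below⇒↭ ε       = ↭-refl
below⇒↭ (c ◅ d) = ↭-trans (cover⇒↭ c) (below⇒↭ d)

below-All : ∀ {P : ℕ → Set} {w u} → Below w u → All P w → All P u
below-All d = All-resp-↭ (below⇒↭ d)

below-length : ∀ {w u} → Below w u → length w ≡ length u
below-length d = ↭-length (below⇒↭ d)

inv-cover : ∀ {w u} → Cover w u → inv w ≡ suc (inv u)
inv-cover (swap-descent {x} {y} {s} y<x) = begin
  count (_<? x) (y ∷ s) + (count (_<? y) s + inv s) ≡⟨ cong (_+ (cy + inv s)) (count-head-yes y<x) ⟩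
  suc (cx + (cy + inv s))                           ≡⟨ cong suc (x∙yz≈y∙xz cx cy (inv s)) ⟩
  suc (cy + (cx + inv s))                           ≡⟨ cong (λ t → suc (t + (cx + inv s))) (sym (count-head-no (<⇒≯ y<x))) ⟩
  suc (count (_<? y) (x ∷ s) + (cx + inv s))        ∎
  where
  open ≡-Reasoning
  cx cy : ℕ
  cx = count (_<? x) s
  cy = count (_<? y) s
  count-head-yes : y < x → count (_<? x) (y ∷ s) ≡ suc cx
  count-head-yes p = cong length (filter-accept (_<? x) p)
  count-head-no : ¬ x < y → count (_<? y) (x ∷ s) ≡ cy
  count-head-no p = cong length (filter-reject (_<? y) p)
inv-cover (under {x} c) = trans (cong₂ _+_ (count-↭ (_<? x) (cover⇒↭ c)) (inv-cover c)) (+-suc _ _)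

-- ℓ decreases along the weak order; this bounds the search depth used by Λ.
below-inv : ∀ {w u} → Below w u → inv u ≤ inv w
below-inv ε       = ≤-refl
below-inv (c ◅ d) rewrite inv-cover c = m≤n⇒m≤1+n (below-inv d)

lowerCovers-complete : ∀ {w u} → Cover w u → u ∈ lowerCovers w
lowerCovers-complete (swap-descent {x} {y} y<x) with y <? x
... | yes _ = here refl
... | no ¬p = ⊥-elim (¬p y<x)
lowerCovers-complete (under {x} {_ ∷ _} c) = ∈-++⁺ʳ _ (∈-map⁺ (x ∷_) (lowerCovers-complete c))

lowerCovers-sound : ∀ {w u} → u ∈ lowerCovers w → Cover w u
lowerCovers-sound {x ∷ y ∷ s} m with y <? x
lowerCovers-sound {x ∷ y ∷ s} (here refl) | yes p = swap-descent p
lowerCovers-sound {x ∷ y ∷ s} (there m)   | yes p with ∈-map⁻ (x ∷_) m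
... | _ , m' , refl = under (lowerCovers-sound m')
lowerCovers-sound {x ∷ y ∷ s} m           | no _ with ∈-map⁻ (x ∷_) m
... | _ , m' , refl = under (lowerCovers-sound m')

-- downFrom f w is the set of elements reached from w by at most f cover steps;
-- reaching u ≤ w takes exactly inv w ∸ inv u steps.
below⇒downFrom : ∀ {w u} → Below w u → ∀ f → inv w ≤ f + inv u → u ∈ downFrom f w
below⇒downFrom ε       zero    _ = here refl
below⇒downFrom ε       (suc f) _ = here refl
below⇒downFrom (c ◅ d) zero    le rewrite inv-cover c = ⊥-elim (<⇒≱ (s≤s (below-inv d)) le)
below⇒downFrom (c ◅ d) (suc f) le rewrite inv-cover c =
  there (∈-concatMap⁺ (downFrom f) (lose (lowerCovers-complete c) (below⇒downFrom d f (≤-pred le))))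

downFrom⇒below : ∀ f {w u} → u ∈ downFrom f w → Below w u
downFrom⇒below zero    (here refl) = ε
downFrom⇒below (suc f) (here refl) = ε
downFrom⇒below (suc f) {w} (there m) with find (∈-concatMap⁻ (downFrom f) {xs = lowerCovers w} m)
... | _ , v∈ , u∈ = lowerCovers-sound v∈ ◅ downFrom⇒below f u∈

Λ-complete : ∀ {w u} → Below w u → u ∈ Λ w
Λ-complete {w} d = ∈-deduplicate⁺ (LP.≡-dec _≟_) (below⇒downFrom d (inv w) (m≤m+n (inv w) _))

Λ-sound : ∀ {w u} → u ∈ Λ w → Below w u
Λ-sound {w} m = downFrom⇒below (inv w) (∈-deduplicate⁻ (LP.≡-dec _≟_) (downFrom (inv w) w) m)

Λ-unique : ∀ w → Unique (Λ w)
Λ-unique w = deduplicate-! (LP.≡-dec _≟_) _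

≈P-setoid : Setoid 0ℓ 0ℓ
≈P-setoid = record
  { Carrier       = Poly
  ; _≈_           = _≈P_
  ; isEquivalence = record
    { refl  = λ _ → refl
    ; sym   = λ e k → sym (e k)
    ; trans = λ e e′ k → trans (e k) (e′ k)
    }
  }

open Setoid ≈P-setoid using () renaming (refl to ≈P-refl; sym to ≈P-sym; trans to ≈P-trans)
module ≈P-Reasoning = SetoidReasoning ≈P-setoid

infixl 6 _+P_
_+P_ : Poly → Poly → Poly
(f +P g) k = f k + g k

infixr 7 _·P_
_·P_ : ℕ → Poly → Poly
(c ·P g) k = c * g k

zeroP : Poly
zeroP _ = 0

-- shiftP c H = q^c · H.
shiftP : ℕ → Poly → Poly
shiftP zero    H k       = H k
shiftP (suc c) H zero    = 0
shiftP (suc c) H (suc k) = shiftP c H k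

monomial : ℕ → Poly
monomial a = shiftP a oneP

*P-suc : ∀ f g k → (f *P g) (suc k) ≡ f 0 * g (suc k) + ((f ∘ suc) *P g) k
*P-suc f g k = cong (f 0 * g (suc k) +_) (cong sum
  (trans (map-applyUpTo suc term (suc k)) (sym (map-applyUpTo id term′ (suc k)))))
  where
  term term′ : ℕ → ℕ
  term  i = f i * g (suc k ∸ i)
  term′ i = f (suc i) * g (k ∸ i)

*P-split : ∀ f g → f *P g ≈P f 0 ·P g +P shiftP 1 ((f ∘ suc) *P g)
*P-split f g zero    = refl
*P-split f g (suc k) = *P-suc f g k

*P-cong : ∀ {f f′ g g′} → f ≈P f′ → g ≈P g′ → f *P g ≈P f′ *P g′
*P-cong ef eg k = cong sum (map-cong (λ i → cong₂ _*_ (ef i) (eg (k ∸ i))) (upTo (suc k)))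

*P-zeroˡ : ∀ g → zeroP *P g ≈P zeroP
*P-zeroˡ g zero    = refl
*P-zeroˡ g (suc k) = trans (*P-suc zeroP g k) (*P-zeroˡ g k)

*P-distribʳ : ∀ f g h → (f +P g) *P h ≈P f *P h +P g *P h
*P-distribʳ f g h zero = solve 3 (λ a b c → (a :+ b) :* c :+ con 0 := (a :* c :+ con 0) :+ (b :* c :+ con 0)) refl (f 0) (g 0) (h 0)
*P-distribʳ f g h (suc k) = begin
  ((f +P g) *P h) (suc k)                                              ≡⟨ *P-suc (f +P g) h k ⟩
  (f 0 + g 0) * h (suc k) + (((f ∘ suc) +P (g ∘ suc)) *P h) k          ≡⟨ cong ((f 0 + g 0) * h (suc k) +_) (*P-distribʳ (f ∘ suc) (g ∘ suc) h k) ⟩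
  (f 0 + g 0) * h (suc k) + (((f ∘ suc) *P h) k + ((g ∘ suc) *P h) k)  ≡⟨ solve 5 (λ a b c d e → (a :+ b) :* c :+ (d :+ e) := (a :* c :+ d) :+ (b :* c :+ e)) refl (f 0) (g 0) (h (suc k)) _ _ ⟩
  (f 0 * h (suc k) + ((f ∘ suc) *P h) k) + (g 0 * h (suc k) + ((g ∘ suc) *P h) k) ≡⟨ sym (cong₂ _+_ (*P-suc f h k) (*P-suc g h k)) ⟩
  (f *P h) (suc k) + (g *P h) (suc k)                                  ∎
  where open ≡-Reasoning

*P-scalarˡ : ∀ c g h → (c ·P g) *P h ≈P c ·P (g *P h)
*P-scalarˡ c g h zero = solve 3 (λ c a b → c :* a :* b :+ con 0 := c :* (a :* b :+ con 0)) refl c (g 0) (h 0)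
*P-scalarˡ c g h (suc k) = begin
  ((c ·P g) *P h) (suc k)                              ≡⟨ *P-suc (c ·P g) h k ⟩
  c * g 0 * h (suc k) + ((c ·P (g ∘ suc)) *P h) k      ≡⟨ cong (c * g 0 * h (suc k) +_) (*P-scalarˡ c (g ∘ suc) h k) ⟩
  c * g 0 * h (suc k) + c * ((g ∘ suc) *P h) k         ≡⟨ solve 4 (λ c a b d → c :* a :* b :+ c :* d := c :* (a :* b :+ d)) refl c (g 0) (h (suc k)) _ ⟩
  c * (g 0 * h (suc k) + ((g ∘ suc) *P h) k)           ≡⟨ cong (c *_) (sym (*P-suc g h k)) ⟩
  c * (g *P h) (suc k)                                 ∎
  where open ≡-Reasoning

*P-assoc : ∀ f g h → (f *P g) *P h ≈P f *P (g *P h)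
*P-assoc f g h zero = begin
  ((f *P g) *P h) 0                                        ≡⟨ *P-cong (*P-split f g) (≈P-refl {h}) 0 ⟩
  ((f 0 ·P g +P shiftP 1 ((f ∘ suc) *P g)) *P h) 0         ≡⟨ *P-distribʳ (f 0 ·P g) (shiftP 1 ((f ∘ suc) *P g)) h 0 ⟩
  ((f 0 ·P g) *P h) 0 + 0                                  ≡⟨ cong (_+ 0) (*P-scalarˡ (f 0) g h 0) ⟩
  f 0 * (g *P h) 0 + 0                                     ∎
  where open ≡-Reasoning
*P-assoc f g h (suc k) = begin
  ((f *P g) *P h) (suc k)                                  ≡⟨ *P-cong (*P-split f g) (≈P-refl {h}) (suc k) ⟩
  ((f 0 ·P g +P shiftP 1 ((f ∘ suc) *P g)) *P h) (suc k)   ≡⟨ *P-distribʳ (f 0 ·P g) (shiftP 1 ((f ∘ suc) *P g)) h (suc k) ⟩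
  ((f 0 ·P g) *P h) (suc k) + (shiftP 1 ((f ∘ suc) *P g) *P h) (suc k)
                                                           ≡⟨ cong₂ _+_ (*P-scalarˡ (f 0) g h (suc k)) (*P-suc (shiftP 1 _) h k) ⟩
  f 0 * (g *P h) (suc k) + (((f ∘ suc) *P g) *P h) k       ≡⟨ cong (f 0 * (g *P h) (suc k) +_) (*P-assoc (f ∘ suc) g h k) ⟩
  f 0 * (g *P h) (suc k) + ((f ∘ suc) *P (g *P h)) k       ≡⟨ sym (*P-suc f (g *P h) k) ⟩
  (f *P (g *P h)) (suc k)                                  ∎
  where open ≡-Reasoning

*P-comm : ∀ f g → f *P g ≈P g *P f
*P-comm f g zero = solve 2 (λ a b → a :* b :+ con 0 := b :* a :+ con 0) refl (f 0) (g 0)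
*P-comm f g (suc zero) = begin
  (f *P g) 1                     ≡⟨ *P-suc f g 0 ⟩
  f 0 * g 1 + (f 1 * g 0 + 0)    ≡⟨ solve 4 (λ a b c d → a :* b :+ (c :* d :+ con 0) := d :* c :+ (b :* a :+ con 0)) refl (f 0) (g 1) (f 1) (g 0) ⟩
  g 0 * f 1 + (g 1 * f 0 + 0)    ≡⟨ sym (*P-suc g f 0) ⟩
  (g *P f) 1                     ∎
  where open ≡-Reasoning
*P-comm f g (suc (suc j)) = begin
  (f *P g) (2 + j)                                       ≡⟨ *P-suc f g (suc j) ⟩
  f 0 * g (2 + j) + (f′ *P g) (suc j)                    ≡⟨ cong (f 0 * g (2 + j) +_) (*P-comm f′ g (suc j)) ⟩
  f 0 * g (2 + j) + (g *P f′) (suc j)                    ≡⟨ cong (f 0 * g (2 + j) +_) (*P-suc g f′ j) ⟩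
  f 0 * g (2 + j) + (g 0 * f (2 + j) + (g′ *P f′) j)     ≡⟨ cong (λ t → f 0 * g (2 + j) + (g 0 * f (2 + j) + t)) (*P-comm g′ f′ j) ⟩
  f 0 * g (2 + j) + (g 0 * f (2 + j) + (f′ *P g′) j)     ≡⟨ x∙yz≈y∙xz (f 0 * g (2 + j)) (g 0 * f (2 + j)) _ ⟩
  g 0 * f (2 + j) + (f 0 * g (2 + j) + (f′ *P g′) j)     ≡⟨ cong (g 0 * f (2 + j) +_) (sym (*P-suc f g′ j)) ⟩
  g 0 * f (2 + j) + (f *P g′) (suc j)                    ≡⟨ cong (g 0 * f (2 + j) +_) (*P-comm f g′ (suc j)) ⟩
  g 0 * f (2 + j) + (g′ *P f) (suc j)                    ≡⟨ sym (*P-suc g f (suc j)) ⟩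
  (g *P f) (2 + j)                                       ∎
  where
  open ≡-Reasoning
  f′ g′ : Poly
  f′ = f ∘ suc
  g′ = g ∘ suc

monomial-*P : ∀ a H → monomial a *P H ≈P shiftP a H
monomial-*P zero    H zero    = trans (+-identityʳ (H 0 + 0)) (+-identityʳ (H 0))
monomial-*P (suc a) H zero    = refl
monomial-*P zero    H (suc k) = begin
  (oneP *P H) (suc k)                       ≡⟨ *P-suc oneP H k ⟩
  (H (suc k) + 0) + ((oneP ∘ suc) *P H) k   ≡⟨ cong₂ _+_ (+-identityʳ (H (suc k))) (*P-zeroˡ H k) ⟩
  H (suc k) + 0                             ≡⟨ +-identityʳ (H (suc k)) ⟩
  H (suc k)                                 ∎
  where open ≡-Reasoning
monomial-*P (suc a) H (suc k) = trans (*P-suc (monomial (suc a)) H k) (monomial-*P a H k)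

oneP-*P : ∀ f → oneP *P f ≈P f
oneP-*P = monomial-*P 0

shiftP-cong : ∀ c {f g} → f ≈P g → shiftP c f ≈P shiftP c g
shiftP-cong zero    e k       = e k
shiftP-cong (suc c) e zero    = refl
shiftP-cong (suc c) e (suc k) = shiftP-cong c e k

shiftP-+P : ∀ c f g → shiftP c (f +P g) ≈P shiftP c f +P shiftP c g
shiftP-+P zero    f g k       = refl
shiftP-+P (suc c) f g zero    = refl
shiftP-+P (suc c) f g (suc k) = shiftP-+P c f g k

shiftP-zeroP : ∀ c → shiftP c zeroP ≈P zeroP
shiftP-zeroP zero    k       = refl
shiftP-zeroP (suc c) zero    = refl
shiftP-zeroP (suc c) (suc k) = shiftP-zeroP c k

shiftP-+ : ∀ c d H → shiftP (c + d) H ≈P shiftP c (shiftP d H)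
shiftP-+ zero    d H k       = refl
shiftP-+ (suc c) d H zero    = refl
shiftP-+ (suc c) d H (suc k) = shiftP-+ c d H k

monomial-same : ∀ a → monomial a a ≡ 1
monomial-same zero    = refl
monomial-same (suc a) = monomial-same a

monomial-other : ∀ a k → a ≢ k → monomial a k ≡ 0
monomial-other zero    zero    ne = ⊥-elim (ne refl)
monomial-other zero    (suc k) ne = refl
monomial-other (suc a) zero    ne = refl
monomial-other (suc a) (suc k) ne = monomial-other a k (ne ∘ cong suc)

shiftP-*P : ∀ c f g → shiftP c f *P g ≈P shiftP c (f *P g)
shiftP-*P c f g = begin
  shiftP c f *P g             ≈⟨ *P-cong (≈P-sym (monomial-*P c f)) (≈P-refl {g}) ⟩
  (monomial c *P f) *P g      ≈⟨ *P-assoc (monomial c) f g ⟩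
  monomial c *P (f *P g)      ≈⟨ monomial-*P c (f *P g) ⟩
  shiftP c (f *P g)           ∎
  where open ≈P-Reasoning

-- Generating polynomials of lists: gen w L = Σ_{u ∈ L} q^{w u}.
-- Note F σ = gen inv (Λ (st σ)).
gen : {A : Set} → (A → ℕ) → List A → Poly
gen w L k = length (filter (λ u → w u ≟ k) L)

gen-∷ : {A : Set} (w : A → ℕ) (u : A) (L : List A) → gen w (u ∷ L) ≈P monomial (w u) +P gen w L
gen-∷ w u L k with w u ≟ k
... | yes refl = trans (cong length (filter-accept (λ v → w v ≟ k) refl)) (cong (_+ gen w L k) (sym (monomial-same k)))
... | no ne    = trans (cong length (filter-reject (λ v → w v ≟ k) ne)) (cong (_+ gen w L k) (sym (monomial-other (w u) k ne)))

gen-++ : {A : Set} (w : A → ℕ) (L₁ L₂ : List A) → gen w (L₁ ++ L₂) ≈P gen w L₁ +P gen w L₂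
gen-++ w L₁ L₂ k = trans (cong length (filter-++ (λ v → w v ≟ k) L₁ L₂)) (length-++ (filter (λ v → w v ≟ k) L₁))

gen-↭ : {A : Set} (w : A → ℕ) {L₁ L₂ : List A} → L₁ ↭ L₂ → gen w L₁ ≈P gen w L₂
gen-↭ w p k = ↭-length (filter-↭ (λ v → w v ≟ k) p)

gen-sameSet : {A : Set} (w : A → ℕ) {L₁ L₂ : List A} → Unique L₁ → Unique L₂ →
  (∀ {u} → u ∈ L₁ → u ∈ L₂) → (∀ {u} → u ∈ L₂ → u ∈ L₁) → gen w L₁ ≈P gen w L₂
gen-sameSet w u₁ u₂ f g = gen-↭ w (∼bag⇒↭ (unique∧set⇒bag u₁ u₂ (mk⇔ f g)))

gen-congʷ : {A : Set} {w w′ : A → ℕ} (L : List A) → All (λ u → w u ≡ w′ u) L → gen w L ≈P gen w′ L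
gen-congʷ         []      []       k = refl
gen-congʷ {w = w} {w′} (u ∷ L) (e ∷ es) k = begin
  gen w (u ∷ L) k                  ≡⟨ gen-∷ w u L k ⟩
  monomial (w u) k + gen w L k     ≡⟨ cong₂ _+_ (cong (λ t → monomial t k) e) (gen-congʷ L es k) ⟩
  monomial (w′ u) k + gen w′ L k   ≡⟨ sym (gen-∷ w′ u L k) ⟩
  gen w′ (u ∷ L) k                 ∎
  where open ≡-Reasoning

gen-map : {A B : Set} (w : B → ℕ) (f : A → B) (L : List A) → gen w (map f L) ≈P gen (w ∘ f) L
gen-map w f []      k = refl
gen-map w f (u ∷ L) k = begin
  gen w (f u ∷ map f L) k                ≡⟨ gen-∷ w (f u) (map f L) k ⟩
  monomial (w (f u)) k + gen w (map f L) k ≡⟨ cong (monomial (w (f u)) k +_) (gen-map w f L k) ⟩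
  monomial (w (f u)) k + gen (w ∘ f) L k ≡⟨ sym (gen-∷ (w ∘ f) u L k) ⟩
  gen (w ∘ f) (u ∷ L) k                  ∎
  where open ≡-Reasoning

gen-shift : {A : Set} (w : A → ℕ) (c : ℕ) (L : List A) → gen (λ u → c + w u) L ≈P shiftP c (gen w L)
gen-shift w c []      = ≈P-sym (shiftP-zeroP c)
gen-shift w c (u ∷ L) = begin
  gen (λ v → c + w v) (u ∷ L)                      ≈⟨ gen-∷ (λ v → c + w v) u L ⟩
  monomial (c + w u) +P gen (λ v → c + w v) L       ≈⟨ (λ k → cong₂ _+_ (shiftP-+ c (w u) oneP k) (gen-shift w c L k)) ⟩
  shiftP c (monomial (w u)) +P shiftP c (gen w L)   ≈⟨ ≈P-sym (shiftP-+P c (monomial (w u)) (gen w L)) ⟩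
  shiftP c (monomial (w u) +P gen w L)              ≈⟨ shiftP-cong c (≈P-sym (gen-∷ w u L)) ⟩
  shiftP c (gen w (u ∷ L))                          ∎
  where open ≈P-Reasoning

gen-concatMap : {A B : Set} (w : B → ℕ) (wA : A → ℕ) (f : A → List B) (H : Poly) (L : List A) →
  (∀ {u} → u ∈ L → gen w (f u) ≈P shiftP (wA u) H) → gen w (concatMap f L) ≈P gen wA L *P H
gen-concatMap w wA f H []      hyp = ≈P-sym (*P-zeroˡ H)
gen-concatMap w wA f H (u ∷ L) hyp = begin
  gen w (f u ++ concatMap f L)                      ≈⟨ gen-++ w (f u) (concatMap f L) ⟩
  gen w (f u) +P gen w (concatMap f L)              ≈⟨ (λ k → cong₂ _+_ (hyp (here refl) k) (gen-concatMap w wA f H L (hyp ∘ there) k)) ⟩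
  shiftP (wA u) H +P gen wA L *P H                  ≈⟨ (λ k → cong (_+ (gen wA L *P H) k) (sym (monomial-*P (wA u) H k))) ⟩
  monomial (wA u) *P H +P gen wA L *P H             ≈⟨ ≈P-sym (*P-distribʳ (monomial (wA u)) (gen wA L) H) ⟩
  (monomial (wA u) +P gen wA L) *P H                ≈⟨ *P-cong (≈P-sym (gen-∷ wA u L)) (≈P-refl {H}) ⟩
  gen wA (u ∷ L) *P H                               ∎
  where open ≈P-Reasoning

unique-concatMap : {A B : Set} (f : A → List B) (key : B → A) (L : List A) → Unique L →
  (∀ {u} → u ∈ L → Unique (f u)) → (∀ {u v} → u ∈ L → v ∈ f u → key v ≡ u) →
  Unique (concatMap f L)
unique-concatMap f key []      _          _  _  = []
unique-concatMap f key (u ∷ L) (u∉ ∷ uL) uf kf =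
  UP.++⁺ (uf (here refl)) (unique-concatMap f key L uL (uf ∘ there) (kf ∘ there)) disjoint
  where
  disjoint : ∀ {v} → v ∈ f u × v ∈ concatMap f L → ⊥
  disjoint (m₁ , m₂) with find (∈-concatMap⁻ f {xs = L} m₂)
  ... | u′ , u′∈ , m₃ = All¬⇒¬Any u∉ (subst (_∈ L) (trans (sym (kf (there u′∈) m₃)) (kf (here refl) m₁)) u′∈)

shiftLetters : ℕ → List ℕ → List ℕ
shiftLetters m = map (m +_)

count-shiftLetters : ∀ m x w → count (_<? m + x) (shiftLetters m w) ≡ count (_<? x) w
count-shiftLetters m x []      = refl
count-shiftLetters m x (y ∷ w) with y <? x
... | yes y<x = trans (cong length (filter-accept (_<? m + x) (+-monoʳ-< m y<x)))
                  (trans (cong suc (count-shiftLetters m x w)) (sym (cong length (filter-accept (_<? x) y<x))))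
... | no y≮x  = trans (cong length (filter-reject (_<? m + x) (y≮x ∘ +-cancelˡ-< m y x)))
                  (trans (count-shiftLetters m x w) (sym (cong length (filter-reject (_<? x) y≮x))))

inv-shiftLetters : ∀ m w → inv (shiftLetters m w) ≡ inv w
inv-shiftLetters m []      = refl
inv-shiftLetters m (x ∷ w) = cong₂ _+_ (count-shiftLetters m x w) (inv-shiftLetters m w)

All-shiftLetters : ∀ m {w} → All (0 <_) w → All (m <_) (shiftLetters m w)
All-shiftLetters m []       = []
All-shiftLetters m (p ∷ ps) = subst (_< m + _) (+-identityʳ m) (+-monoʳ-< m p) ∷ All-shiftLetters m ps

inv-++ : ∀ {k} u v → All (_≤ k) u → All (k <_) v → inv (u ++ v) ≡ inv u + inv v
inv-++ []      v _         _  = refl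
inv-++ {k} (x ∷ u) v (x≤k ∷ pu) pv = begin
  count (_<? x) (u ++ v) + inv (u ++ v)              ≡⟨ cong₂ _+_ (count-++ (_<? x) u v) (inv-++ u v pu pv) ⟩
  (count (_<? x) u + count (_<? x) v) + (inv u + inv v) ≡⟨ cong (λ t → (count (_<? x) u + t) + (inv u + inv v)) (count-none (_<? x) (All.map v≮x pv)) ⟩
  (count (_<? x) u + 0) + (inv u + inv v)            ≡⟨ solve 3 (λ a b c → (a :+ con 0) :+ (b :+ c) := (a :+ b) :+ c) refl (count (_<? x) u) (inv u) (inv v) ⟩
  (count (_<? x) u + inv u) + inv v                  ∎
  where
  open ≡-Reasoning
  v≮x : ∀ {z} → k < z → ¬ z < x
  v≮x k<z z<x = <-asym z<x (≤-<-trans x≤k k<z)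

cover-++ˡ : ∀ b {a a′} → Cover a a′ → Cover (a ++ b) (a′ ++ b)
cover-++ˡ b (swap-descent p) = swap-descent p
cover-++ˡ b (under c)        = under (cover-++ˡ b c)

cover-++ʳ : ∀ a {b b′} → Cover b b′ → Cover (a ++ b) (a ++ b′)
cover-++ʳ []      c = c
cover-++ʳ (x ∷ a) c = under (cover-++ʳ a c)

below-++ˡ : ∀ b {a a′} → Below a a′ → Below (a ++ b) (a′ ++ b)
below-++ˡ b = gmap (_++ b) (cover-++ˡ b)

below-++ʳ : ∀ a {b b′} → Below b b′ → Below (a ++ b) (a ++ b′)
below-++ʳ a = gmap (a ++_) (cover-++ʳ a)

below-∷ : ∀ x {b b′} → Below b b′ → Below (x ∷ b) (x ∷ b′)
below-∷ x = below-++ʳ (x ∷ [])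

cover-shift : ∀ m {w u} → Cover w u → Cover (shiftLetters m w) (shiftLetters m u)
cover-shift m (swap-descent p) = swap-descent (+-monoʳ-< m p)
cover-shift m (under c)        = under (cover-shift m c)

below-shift : ∀ m {w u} → Below w u → Below (shiftLetters m w) (shiftLetters m u)
below-shift m = gmap (shiftLetters m) (cover-shift m)

cover-unshift : ∀ m {w u} → Cover (shiftLetters m w) u → ∃ λ u′ → Cover w u′ × u ≡ shiftLetters m u′
cover-unshift m {x ∷ y ∷ s} (swap-descent p) = y ∷ x ∷ s , swap-descent (+-cancelˡ-< m _ _ p) , refl
cover-unshift m {x ∷ w}     (under c) with cover-unshift m c
... | u′ , c′ , refl = x ∷ u′ , under c′ , refl

below-unshift : ∀ m {w u} → Below (shiftLetters m w) u → ∃ λ u′ → Below w u′ × u ≡ shiftLetters m u′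
below-unshift m ε = _ , ε , refl
below-unshift m (c ◅ d) with cover-unshift m c
... | _ , c′ , refl with below-unshift m d
... | u′ , d′ , eq = u′ , c′ ◅ d′ , eq

-- Below a direct sum a ++ b (letters of a below those of b) every element is
-- a′ ++ b′ with a′ ≤ a and b′ ≤ b: no descent straddles the junction.
cover-directSum : ∀ {k} a b → All (_≤ k) a → All (k <_) b → ∀ {u} → Cover (a ++ b) u →
  (∃ λ a′ → Cover a a′ × u ≡ a′ ++ b) ⊎ (∃ λ b′ → Cover b b′ × u ≡ a ++ b′)
cover-directSum []          b _          _          c = inj₂ (_ , c , refl)
cover-directSum (x ∷ [])    (y ∷ s) (x≤k ∷ []) (k<y ∷ _) (swap-descent y<x) = ⊥-elim (<-asym y<x (≤-<-trans x≤k k<y))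
cover-directSum (x ∷ [])    b _          _          (under c) = inj₂ (_ , c , refl)
cover-directSum (x ∷ y ∷ a) b _          _          (swap-descent p) = inj₁ (_ , swap-descent p , refl)
cover-directSum (x ∷ y ∷ a) b (_ ∷ pa)   pb         (under c) with cover-directSum (y ∷ a) b pa pb c
... | inj₁ (a′ , c′ , refl) = inj₁ (x ∷ a′ , under c′ , refl)
... | inj₂ (b′ , c′ , refl) = inj₂ (b′ , c′ , refl)

below-directSum : ∀ {k} a b → All (_≤ k) a → All (k <_) b → ∀ {u} → Below (a ++ b) u →
  ∃₂ λ a′ b′ → Below a a′ × Below b b′ × u ≡ a′ ++ b′
below-directSum a b pa pb ε = a , b , ε , ε , refl
below-directSum a b pa pb (c ◅ d) with cover-directSum a b pa pb c
... | inj₁ (a″ , c′ , refl) with below-directSum a″ b (All-resp-↭ (cover⇒↭ c′) pa) pb d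
...   | a′ , b′ , da , db , eq = a′ , b′ , c′ ◅ da , db , eq
below-directSum a b pa pb (c ◅ d) | inj₂ (b″ , c′ , refl) with below-directSum a b″ pa (All-resp-↭ (cover⇒↭ c′) pb) d
...   | a′ , b′ , da , db , eq = a′ , b′ , da , c′ ◅ db , eq

data Shuffle : List ℕ → List ℕ → List ℕ → Set where
  []    : Shuffle [] [] []
  left  : ∀ {a x y v} → Shuffle x y v → Shuffle (a ∷ x) y (a ∷ v)
  right : ∀ {b x y v} → Shuffle x y v → Shuffle x (b ∷ y) (b ∷ v)

shuffles : List ℕ → List ℕ → List (List ℕ)
shuffles []      y       = y ∷ []
shuffles (a ∷ x) []      = (a ∷ x) ∷ []
shuffles (a ∷ x) (b ∷ y) = map (a ∷_) (shuffles x (b ∷ y)) ++ map (b ∷_) (shuffles (a ∷ x) y)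

shuffle-[]ˡ : ∀ y → Shuffle [] y y
shuffle-[]ˡ []      = []
shuffle-[]ˡ (b ∷ y) = right (shuffle-[]ˡ y)

shuffle-[]ʳ : ∀ x → Shuffle x [] x
shuffle-[]ʳ []      = []
shuffle-[]ʳ (a ∷ x) = left (shuffle-[]ʳ x)

shuffle-[]ˡ⁻ : ∀ {y v} → Shuffle [] y v → v ≡ y
shuffle-[]ˡ⁻ []        = refl
shuffle-[]ˡ⁻ (right s) = cong (_ ∷_) (shuffle-[]ˡ⁻ s)

shuffle-[]ʳ⁻ : ∀ {x v} → Shuffle x [] v → v ≡ x
shuffle-[]ʳ⁻ []       = refl
shuffle-[]ʳ⁻ (left s) = cong (_ ∷_) (shuffle-[]ʳ⁻ s)

shuffle-++ : ∀ x y → Shuffle x y (x ++ y)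
shuffle-++ []      y = shuffle-[]ˡ y
shuffle-++ (a ∷ x) y = left (shuffle-++ x y)

shuffles-complete : ∀ {x y v} → Shuffle x y v → v ∈ shuffles x y
shuffles-complete {[]}             s rewrite shuffle-[]ˡ⁻ s = here refl
shuffles-complete {a ∷ x} {[]}     s rewrite shuffle-[]ʳ⁻ s = here refl
shuffles-complete {a ∷ x} {b ∷ y} (left s)  = ∈-++⁺ˡ (∈-map⁺ (a ∷_) (shuffles-complete s))
shuffles-complete {a ∷ x} {b ∷ y} (right s) = ∈-++⁺ʳ _ (∈-map⁺ (b ∷_) (shuffles-complete s))

shuffles-sound : ∀ {x y v} → v ∈ shuffles x y → Shuffle x y v
shuffles-sound {[]}    {y}     (here refl) = shuffle-[]ˡ y
shuffles-sound {a ∷ x} {[]}    (here refl) = shuffle-[]ʳ (a ∷ x)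
shuffles-sound {a ∷ x} {b ∷ y} m with ∈-++⁻ (map (a ∷_) (shuffles x (b ∷ y))) m
... | inj₁ m′ with ∈-map⁻ (a ∷_) m′
...   | _ , m″ , refl = left (shuffles-sound m″)
shuffles-sound {a ∷ x} {b ∷ y} m | inj₂ m′ with ∈-map⁻ (b ∷_) m′
...   | _ , m″ , refl = right (shuffles-sound m″)

shuffle⇒↭ : ∀ {x y v} → Shuffle x y v → x ++ y ↭ v
shuffle⇒↭ []                    = ↭-refl
shuffle⇒↭ (left s)              = Perm.prep _ (shuffle⇒↭ s)
shuffle⇒↭ {x} {b ∷ y} (right s) = ↭-trans (↭-shift b x y) (Perm.prep b (shuffle⇒↭ s))

shuffle-map : ∀ (f : ℕ → ℕ) {x y v} → Shuffle x y v → Shuffle (map f x) (map f y) (map f v)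
shuffle-map f []        = []
shuffle-map f (left s)  = left (shuffle-map f s)
shuffle-map f (right s) = right (shuffle-map f s)

-- Shuffles of a high word x with a low word y are pairwise distinct:
-- the first letter already tells which word it came from.
shuffles-unique : ∀ {k} x y → All (k <_) x → All (_≤ k) y → Unique (shuffles x y)
shuffles-unique []      y       px         py         = [] ∷ []
shuffles-unique (a ∷ x) []      px         py         = [] ∷ []
shuffles-unique (a ∷ x) (b ∷ y) (k<a ∷ px) (b≤k ∷ py) =
  UP.++⁺ (UP.map⁺ ∷-injectiveʳ (shuffles-unique x (b ∷ y) px (b≤k ∷ py)))
         (UP.map⁺ ∷-injectiveʳ (shuffles-unique (a ∷ x) y (k<a ∷ px) py))
         disjoint
  where
  disjoint : ∀ {v} → v ∈ map (a ∷_) (shuffles x (b ∷ y)) × v ∈ map (b ∷_) (shuffles (a ∷ x) y) → ⊥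
  disjoint (m₁ , m₂) with ∈-map⁻ (a ∷_) m₁ | ∈-map⁻ (b ∷_) m₂
  ... | _ , _ , refl | _ , _ , eq = <-irrefl (sym (∷-injectiveˡ eq)) (≤-<-trans b≤k k<a)

shuffle-unzip : ∀ {k x y v} → All (k <_) x → All (_≤ k) y → Shuffle x y v →
  filter (k <?_) v ≡ x × filter (_≤? k) v ≡ y
shuffle-unzip px py [] = refl , refl
shuffle-unzip {k} (k<a ∷ px) py (left s) with shuffle-unzip px py s
... | ex , ey = trans (filter-accept (k <?_) k<a) (cong (_ ∷_) ex) , trans (filter-reject (_≤? k) (<⇒≱ k<a)) ey
shuffle-unzip {k} px (b≤k ∷ py) (right s) with shuffle-unzip px py s
... | ex , ey = trans (filter-reject (k <?_) (≤⇒≯ b≤k)) ex , trans (filter-accept (_≤? k) b≤k) (cong (_ ∷_) ey)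

cover-shuffle : ∀ {k x y v u} → All (k <_) x → All (_≤ k) y → Shuffle x y v → Cover v u →
  ∃₂ λ x′ y′ → Below x x′ × Below y y′ × Shuffle x′ y′ u
cover-shuffle px         py         (left (left s))   (swap-descent p) = _ , _ , swap-descent p ◅ ε , ε , left (left s)
cover-shuffle px         py         (left (right s))  (swap-descent p) = _ , _ , ε , ε , right (left s)
cover-shuffle (k<c ∷ _) (b≤k ∷ _) (right (left s))  (swap-descent c<b) = ⊥-elim (<-asym c<b (≤-<-trans b≤k k<c))
cover-shuffle px         py         (right (right s)) (swap-descent p) = _ , _ , ε , swap-descent p ◅ ε , right (right s)
cover-shuffle (_ ∷ px)   py         (left s)  (under c) with cover-shuffle px py s c
... | x′ , y′ , dx , dy , s′ = _ , y′ , below-∷ _ dx , dy , left s′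
cover-shuffle px         (_ ∷ py)   (right s) (under c) with cover-shuffle px py s c
... | x′ , y′ , dx , dy , s′ = x′ , _ , dx , below-∷ _ dy , right s′

below-skewSum⁻ : ∀ {k} x y → All (k <_) x → All (_≤ k) y → ∀ {v} → Below (x ++ y) v →
  ∃₂ λ x′ y′ → Below x x′ × Below y y′ × Shuffle x′ y′ v
below-skewSum⁻ x y px py = go ε ε (shuffle-++ x y)
  where
  go : ∀ {x₁ y₁ w v} → Below x x₁ → Below y y₁ → Shuffle x₁ y₁ w → Below w v →
    ∃₂ λ x′ y′ → Below x x′ × Below y y′ × Shuffle x′ y′ v
  go dx dy s ε = _ , _ , dx , dy , s
  go dx dy s (c ◅ d) with cover-shuffle (below-All dx px) (below-All dy py) s c
  ... | _ , _ , dx′ , dy′ , s′ = go (dx ◅◅ dx′) (dy ◅◅ dy′) s′ d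

bubble : ∀ b x z → All (b <_) x → Below (x ++ b ∷ z) (b ∷ x ++ z)
bubble b []      z _        = ε
bubble b (a ∷ x) z (b<a ∷ ps) = below-∷ a (bubble b x z ps) ◅◅ (swap-descent b<a ◅ ε)

shuffle-below : ∀ {k x y v} → All (k <_) x → All (_≤ k) y → Shuffle x y v → Below (x ++ y) v
shuffle-below px         py         []        = ε
shuffle-below (_ ∷ px)   py         (left s)  = below-∷ _ (shuffle-below px py s)
shuffle-below {x = x} {b ∷ y} px (b≤k ∷ py) (right s) =
  bubble b x y (All.map (≤-<-trans b≤k) px) ◅◅ below-∷ b (shuffle-below px py s)

below-skewSum⁺ : ∀ {k x y x′ y′ v} → All (k <_) x → All (_≤ k) y →
  Below x x′ → Below y y′ → Shuffle x′ y′ v → Below (x ++ y) v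
below-skewSum⁺ px py dx dy s =
  below-++ˡ _ dx ◅◅ below-++ʳ _ dy ◅◅ shuffle-below (below-All dx px) (below-All dy py) s

above : ℕ → ℕ → ℕ
above k c with k <? c
... | yes _ = 1
... | no _  = 0

above-yes : ∀ {k c} → k < c → above k c ≡ 1
above-yes {k} {c} p with k <? c
... | yes _ = refl
... | no ¬p = ⊥-elim (¬p p)

above-no : ∀ {k c} → c ≤ k → above k c ≡ 0
above-no {k} {c} p with k <? c
... | yes q = ⊥-elim (<⇒≱ q p)
... | no _  = refl

profile : ℕ → List ℕ → List ℕ
profile k = map (above k)

profile-high : ∀ {k} x → All (k <_) x → profile k x ≡ replicate (length x) 1
profile-high []      []       = refl
profile-high (a ∷ x) (p ∷ ps) = cong₂ _∷_ (above-yes p) (profile-high x ps)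

profile-low : ∀ {k} y → All (_≤ k) y → profile k y ≡ replicate (length y) 0
profile-low []      []       = refl
profile-low (a ∷ y) (p ∷ ps) = cong₂ _∷_ (above-no p) (profile-low y ps)

profile-shuffles : ∀ {k} x y → All (k <_) x → All (_≤ k) y →
  map (profile k) (shuffles x y) ≡ shuffles (replicate (length x) 1) (replicate (length y) 0)
profile-shuffles []      y       px         py         = cong (_∷ []) (profile-low y py)
profile-shuffles (a ∷ x) []      px         py         = cong (_∷ []) (profile-high (a ∷ x) px)
profile-shuffles {k} (a ∷ x) (b ∷ y) (k<a ∷ px) (b≤k ∷ py) = begin
  map (profile k) (map (a ∷_) S₁ ++ map (b ∷_) S₂)                  ≡⟨ map-++ (profile k) (map (a ∷_) S₁) _ ⟩
  map (profile k) (map (a ∷_) S₁) ++ map (profile k) (map (b ∷_) S₂) ≡⟨ cong₂ _++_ (headed (above-yes k<a) S₁) (headed (above-no b≤k) S₂) ⟩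
  map (1 ∷_) (map (profile k) S₁) ++ map (0 ∷_) (map (profile k) S₂) ≡⟨ cong₂ _++_ (cong (map (1 ∷_)) (profile-shuffles x (b ∷ y) px (b≤k ∷ py)))
                                                                                   (cong (map (0 ∷_)) (profile-shuffles (a ∷ x) y (k<a ∷ px) py)) ⟩
  shuffles (replicate (length (a ∷ x)) 1) (replicate (length (b ∷ y)) 0) ∎
  where
  open ≡-Reasoning
  S₁ S₂ : List (List ℕ)
  S₁ = shuffles x (b ∷ y)
  S₂ = shuffles (a ∷ x) y
  headed : ∀ {c e} → above k c ≡ e → ∀ S → map (profile k) (map (c ∷_) S) ≡ map (e ∷_) (map (profile k) S)
  headed eq S = trans (sym (map-∘ S)) (trans (map-cong (λ s → cong (_∷ profile k s) eq) S) (map-∘ S))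

count-<1-ones : ∀ n → count (_<? 1) (replicate n 1) ≡ 0
count-<1-ones n = count-none (_<? 1) (replicate⁺ n (<-irrefl refl))

count-<1-zeros : ∀ n → count (_<? 1) (replicate n 0) ≡ n
count-<1-zeros n = trans (count-all (_<? 1) (replicate⁺ n (s≤s z≤n))) (length-replicate n)

count-<0 : ∀ w → count (_<? 0) w ≡ 0
count-<0 w = count-none (_<? 0) {w} (All.tabulate (λ _ → n≮0))

-- Inversions of a shuffle of a high x with a low y: those inside x, those
-- inside y, and one for each (high, low) pair in the wrong order, i.e. the
-- inversions of the profile.
inv-shuffle : ∀ {k x y v} → All (k <_) x → All (_≤ k) y → Shuffle x y v →
  inv v ≡ inv x + inv y + inv (profile k v)
inv-shuffle px py [] = refl
inv-shuffle {k} {a ∷ x} {y} {a ∷ v} (k<a ∷ px) py (left s) = begin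
  count (_<? a) v + inv v                                          ≡⟨ cong₂ _+_ (split (_<? a) s) (inv-shuffle px py s) ⟩
  (count (_<? a) x + count (_<? a) y) + (inv x + inv y + inv p)    ≡⟨ cong (λ t → (count (_<? a) x + t) + (inv x + inv y + inv p)) (count-all (_<? a) (All.map (λ z≤k → ≤-<-trans z≤k k<a) py)) ⟩
  (count (_<? a) x + length y) + (inv x + inv y + inv p)           ≡⟨ solve 5 (λ c l ix iy ip → (c :+ l) :+ (ix :+ iy :+ ip) := (c :+ ix) :+ iy :+ (l :+ ip)) refl (count (_<? a) x) (length y) (inv x) (inv y) (inv p) ⟩
  (count (_<? a) x + inv x) + inv y + (length y + inv p)           ≡⟨ cong (λ t → (count (_<? a) x + inv x) + inv y + (t + inv p)) (sym lowCount) ⟩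
  (count (_<? a) x + inv x) + inv y + (count (_<? 1) p + inv p)    ≡⟨ cong (λ t → (count (_<? a) x + inv x) + inv y + (count (_<? t) p + inv p)) (sym (above-yes k<a)) ⟩
  (count (_<? a) x + inv x) + inv y + inv (above k a ∷ p)          ∎
  where
  open ≡-Reasoning
  p : List ℕ
  p = profile k v
  split : ∀ {P : ℕ → Set} (P? : Decidable P) {x y v} → Shuffle x y v → count P? v ≡ count P? x + count P? y
  split P? {x} {y} s = trans (sym (count-↭ P? (shuffle⇒↭ s))) (count-++ P? x y)
  lowCount : count (_<? 1) p ≡ length y
  lowCount = begin
    count (_<? 1) p                                      ≡⟨ split (_<? 1) (shuffle-map (above k) s) ⟩
    count (_<? 1) (profile k x) + count (_<? 1) (profile k y) ≡⟨ cong₂ _+_ (cong (count (_<? 1)) (profile-high x px)) (cong (count (_<? 1)) (profile-low y py)) ⟩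
    count (_<? 1) (replicate (length x) 1) + count (_<? 1) (replicate (length y) 0) ≡⟨ cong₂ _+_ (count-<1-ones (length x)) (count-<1-zeros (length y)) ⟩
    length y                                             ∎
inv-shuffle {k} {x} {b ∷ y} {b ∷ v} px (b≤k ∷ py) (right s) = begin
  count (_<? b) v + inv v                                          ≡⟨ cong₂ _+_ (trans (sym (count-↭ (_<? b) (shuffle⇒↭ s))) (count-++ (_<? b) x y)) (inv-shuffle px py s) ⟩
  (count (_<? b) x + count (_<? b) y) + (inv x + inv y + inv p)    ≡⟨ cong (λ t → (t + count (_<? b) y) + (inv x + inv y + inv p)) (count-none (_<? b) (All.map (λ k<z z<b → <-asym z<b (≤-<-trans b≤k k<z)) px)) ⟩
  (0 + count (_<? b) y) + (inv x + inv y + inv p)                  ≡⟨ solve 4 (λ c ix iy ip → (con 0 :+ c) :+ (ix :+ iy :+ ip) := ix :+ (c :+ iy) :+ ip) refl (count (_<? b) y) (inv x) (inv y) (inv p) ⟩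
  inv x + (count (_<? b) y + inv y) + inv p                        ≡⟨ cong (λ t → inv x + (count (_<? b) y + inv y) + (t + inv p)) (sym (count-<0 p)) ⟩
  inv x + (count (_<? b) y + inv y) + (count (_<? 0) p + inv p)    ≡⟨ cong (λ t → inv x + (count (_<? b) y + inv y) + (count (_<? t) p + inv p)) (sym (above-no b≤k)) ⟩
  inv x + (count (_<? b) y + inv y) + inv (above k b ∷ p)          ∎
  where
  open ≡-Reasoning
  p : List ℕ
  p = profile k v

-- FΛ w = F(Λ_w, q) for a word w (no standardisation); F σ = FΛ (st σ).
FΛ : List ℕ → Poly
FΛ w = gen inv (Λ w)

FΛ-shiftLetters : ∀ m w → FΛ (shiftLetters m w) ≈P FΛ w
FΛ-shiftLetters m w = begin
  gen inv (Λ (shiftLetters m w))              ≈⟨ gen-sameSet inv (Λ-unique _) unique into-image from-image ⟩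
  gen inv (map (shiftLetters m) (Λ w))        ≈⟨ gen-map inv (shiftLetters m) (Λ w) ⟩
  gen (inv ∘ shiftLetters m) (Λ w)            ≈⟨ gen-congʷ (Λ w) (All.tabulate (λ {u} _ → inv-shiftLetters m u)) ⟩
  gen inv (Λ w)                               ∎
  where
  open ≈P-Reasoning
  unique : Unique (map (shiftLetters m) (Λ w))
  unique = UP.map⁺ (map-injective (+-cancelˡ-≡ m _ _)) (Λ-unique w)
  into-image : ∀ {u} → u ∈ Λ (shiftLetters m w) → u ∈ map (shiftLetters m) (Λ w)
  into-image u∈ with below-unshift m (Λ-sound u∈)
  ... | u′ , d , refl = ∈-map⁺ (shiftLetters m) (Λ-complete d)
  from-image : ∀ {u} → u ∈ map (shiftLetters m) (Λ w) → u ∈ Λ (shiftLetters m w)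
  from-image u∈ with ∈-map⁻ (shiftLetters m) u∈
  ... | u′ , u′∈ , refl = Λ-complete (below-shift m (Λ-sound u′∈))

-- Direct sum: Λ_{a ++ b} ≅ Λ_a × Λ_b with ℓ additive, so F factorises.
module DirectSum {k : ℕ} (a b : List ℕ) (a≤k : All (_≤ k) a) (k<b : All (k <_) b) where

  withPrefix : List ℕ → List (List ℕ)
  withPrefix a′ = map (a′ ++_) (Λ b)

  enumeration : List (List ℕ)
  enumeration = concatMap withPrefix (Λ a)

  unique : Unique enumeration
  unique = unique-concatMap withPrefix (take (length a)) (Λ a) (Λ-unique a)
    (λ {a′} _ → UP.map⁺ (++-cancelˡ a′ _ _) (Λ-unique b)) prefixKey
    where
    prefixKey : ∀ {a′ v} → a′ ∈ Λ a → v ∈ withPrefix a′ → take (length a) v ≡ a′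
    prefixKey {a′} a′∈ v∈ with ∈-map⁻ (a′ ++_) v∈
    ... | b′ , _ , refl = subst (λ t → take t (a′ ++ b′) ≡ a′) (sym (below-length (Λ-sound a′∈))) (take-++-length a′ b′)

  sound : ∀ {v} → v ∈ enumeration → v ∈ Λ (a ++ b)
  sound v∈ with find (∈-concatMap⁻ withPrefix {xs = Λ a} v∈)
  ... | a′ , a′∈ , v∈′ with ∈-map⁻ _ v∈′
  ...   | b′ , b′∈ , refl = Λ-complete (below-++ˡ b (Λ-sound a′∈) ◅◅ below-++ʳ a′ (Λ-sound b′∈))

  complete : ∀ {v} → v ∈ Λ (a ++ b) → v ∈ enumeration
  complete v∈ with below-directSum a b a≤k k<b (Λ-sound v∈)
  ... | a′ , b′ , da , db , refl = ∈-concatMap⁺ withPrefix (lose (Λ-complete da) (∈-map⁺ (a′ ++_) (Λ-complete db)))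

  block : ∀ {a′} → a′ ∈ Λ a → gen inv (withPrefix a′) ≈P shiftP (inv a′) (FΛ b)
  block {a′} a′∈ = begin
    gen inv (map (a′ ++_) (Λ b))           ≈⟨ gen-map inv (a′ ++_) (Λ b) ⟩
    gen (λ v → inv (a′ ++ v)) (Λ b)        ≈⟨ gen-congʷ (Λ b) (All.tabulate additive) ⟩
    gen (λ v → inv a′ + inv v) (Λ b)       ≈⟨ gen-shift inv (inv a′) (Λ b) ⟩
    shiftP (inv a′) (FΛ b)                 ∎
    where
    open ≈P-Reasoning
    additive : ∀ {b′} → b′ ∈ Λ b → inv (a′ ++ b′) ≡ inv a′ + inv b′
    additive b′∈ = inv-++ a′ _ (below-All (Λ-sound a′∈) a≤k) (below-All (Λ-sound b′∈) k<b)

  FΛ-directSum : FΛ (a ++ b) ≈P FΛ a *P FΛ b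
  FΛ-directSum = ≈P-trans (gen-sameSet inv (Λ-unique _) unique complete sound)
                          (gen-concatMap inv inv withPrefix (FΛ b) (Λ a) block)

-- The inversion polynomial of all 0/1 words with p ones and r zeros
-- (by qfact-split below, the q-binomial coefficient).
shuffleGen : ℕ → ℕ → Poly
shuffleGen p r = gen inv (shuffles (replicate p 1) (replicate r 0))

-- Skew sum: Λ_{x ++ y} is the disjoint union, over x′ ∈ Λ_x and y′ ∈ Λ_y,
-- of all shuffles of x′ and y′, and ℓ splits as ℓ(x′) + ℓ(y′) + ℓ(profile).
module SkewSum {k : ℕ} (x y : List ℕ) (k<x : All (k <_) x) (y≤k : All (_≤ k) y) where

  withTop : List ℕ → List (List ℕ)
  withTop x′ = concatMap (shuffles x′) (Λ y)

  enumeration : List (List ℕ)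
  enumeration = concatMap withTop (Λ x)

  high : ∀ {x′} → x′ ∈ Λ x → All (k <_) x′
  high x′∈ = below-All (Λ-sound x′∈) k<x

  low : ∀ {y′} → y′ ∈ Λ y → All (_≤ k) y′
  low y′∈ = below-All (Λ-sound y′∈) y≤k

  unique : Unique enumeration
  unique = unique-concatMap withTop (filter (k <?_)) (Λ x) (Λ-unique x) uniqueTop topKey
    where
    uniqueTop : ∀ {x′} → x′ ∈ Λ x → Unique (withTop x′)
    uniqueTop {x′} x′∈ = unique-concatMap (shuffles x′) (filter (_≤? k)) (Λ y) (Λ-unique y)
      (λ y′∈ → shuffles-unique x′ _ (high x′∈) (low y′∈))
      (λ y′∈ v∈ → proj₂ (shuffle-unzip (high x′∈) (low y′∈) (shuffles-sound v∈)))
    topKey : ∀ {x′ v} → x′ ∈ Λ x → v ∈ withTop x′ → filter (k <?_) v ≡ x′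
    topKey x′∈ v∈ with find (∈-concatMap⁻ _ {xs = Λ y} v∈)
    ... | _ , y′∈ , v∈′ = proj₁ (shuffle-unzip (high x′∈) (low y′∈) (shuffles-sound v∈′))

  sound : ∀ {v} → v ∈ enumeration → v ∈ Λ (x ++ y)
  sound v∈ with find (∈-concatMap⁻ withTop {xs = Λ x} v∈)
  ... | x′ , x′∈ , v∈′ with find (∈-concatMap⁻ (shuffles x′) {xs = Λ y} v∈′)
  ...   | y′ , y′∈ , v∈″ = Λ-complete (below-skewSum⁺ k<x y≤k (Λ-sound x′∈) (Λ-sound y′∈) (shuffles-sound v∈″))

  complete : ∀ {v} → v ∈ Λ (x ++ y) → v ∈ enumeration
  complete v∈ with below-skewSum⁻ x y k<x y≤k (Λ-sound v∈)
  ... | x′ , y′ , dx , dy , s = ∈-concatMap⁺ withTop (lose (Λ-complete dx)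
                                  (∈-concatMap⁺ (shuffles x′) (lose (Λ-complete dy) (shuffles-complete s))))

  G : Poly
  G = shuffleGen (length x) (length y)

  shuffleBlock : ∀ {x′ y′} → x′ ∈ Λ x → y′ ∈ Λ y → gen inv (shuffles x′ y′) ≈P shiftP (inv x′ + inv y′) G
  shuffleBlock {x′} {y′} x′∈ y′∈ = begin
    gen inv S                                         ≈⟨ gen-congʷ S (All.tabulate (λ v∈ → inv-shuffle (high x′∈) (low y′∈) (shuffles-sound v∈))) ⟩
    gen (λ v → (inv x′ + inv y′) + inv (profile k v)) S ≈⟨ gen-shift (inv ∘ profile k) (inv x′ + inv y′) S ⟩
    shiftP (inv x′ + inv y′) (gen (inv ∘ profile k) S) ≈⟨ shiftP-cong (inv x′ + inv y′) (≈P-sym (gen-map inv (profile k) S)) ⟩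
    shiftP (inv x′ + inv y′) (gen inv (map (profile k) S)) ≈⟨ shiftP-cong (inv x′ + inv y′) (λ i → cong (λ L → gen inv L i) profiles) ⟩
    shiftP (inv x′ + inv y′) G                        ∎
    where
    open ≈P-Reasoning
    S : List (List ℕ)
    S = shuffles x′ y′
    profiles : map (profile k) S ≡ shuffles (replicate (length x) 1) (replicate (length y) 0)
    profiles = trans (profile-shuffles x′ y′ (high x′∈) (low y′∈))
      (sym (cong₂ (λ p r → shuffles (replicate p 1) (replicate r 0)) (below-length (Λ-sound x′∈)) (below-length (Λ-sound y′∈))))

  topBlock : ∀ {x′} → x′ ∈ Λ x → gen inv (withTop x′) ≈P shiftP (inv x′) (FΛ y *P G)
  topBlock {x′} x′∈ = begin
    gen inv (withTop x′)                              ≈⟨ gen-concatMap inv (λ y′ → inv x′ + inv y′) (shuffles x′) G (Λ y) (shuffleBlock x′∈) ⟩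
    gen (λ y′ → inv x′ + inv y′) (Λ y) *P G           ≈⟨ *P-cong (gen-shift inv (inv x′) (Λ y)) (≈P-refl {G}) ⟩
    shiftP (inv x′) (FΛ y) *P G                       ≈⟨ shiftP-*P (inv x′) (FΛ y) G ⟩
    shiftP (inv x′) (FΛ y *P G)                       ∎
    where open ≈P-Reasoning

  FΛ-skewSum : FΛ (x ++ y) ≈P FΛ x *P (FΛ y *P G)
  FΛ-skewSum = ≈P-trans (gen-sameSet inv (Λ-unique _) unique complete sound)
                        (gen-concatMap inv inv withTop (FΛ y *P G) (Λ x) topBlock)

qint-yes : ∀ {i k} → k < i → qint i k ≡ 1
qint-yes {i} {k} p with k <? i
... | yes _ = refl
... | no ¬p = ⊥-elim (¬p p)

qint-no : ∀ {i k} → ¬ k < i → qint i k ≡ 0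
qint-no {i} {k} p with k <? i
... | yes q = ⊥-elim (p q)
... | no _  = refl

qint-suc : ∀ n → qint (suc n) ≈P monomial n +P qint n
qint-suc n k with <-cmp k n
... | tri< k<n k≢n _ = trans (qint-yes (m<n⇒m<1+n k<n)) (sym (cong₂ _+_ (monomial-other n k (k≢n ∘ sym)) (qint-yes k<n)))
... | tri≈ _ refl _  = trans (qint-yes (n<1+n k)) (sym (cong₂ _+_ (monomial-same k) (qint-no (<-irrefl refl))))
... | tri> _ k≢n n<k = trans (qint-no (<⇒≱ n<k ∘ ≤-pred)) (sym (cong₂ _+_ (monomial-other n k (k≢n ∘ sym)) (qint-no (<-asym n<k))))

inv-zeros : ∀ n → inv (replicate n 0) ≡ 0
inv-zeros zero    = refl
inv-zeros (suc n) = cong₂ _+_ (count-<0 (replicate n 0)) (inv-zeros n)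

shuffleGen-1 : ∀ n → shuffleGen 1 n ≈P qint (suc n)
shuffleGen-1 zero zero    = refl
shuffleGen-1 zero (suc k) = refl
shuffleGen-1 (suc n) = begin
  gen inv ((1 ∷ 0 ∷ replicate n 0) ∷ map (0 ∷_) S)               ≈⟨ gen-∷ inv (1 ∷ 0 ∷ replicate n 0) (map (0 ∷_) S) ⟩
  monomial (inv (1 ∷ 0 ∷ replicate n 0)) +P gen inv (map (0 ∷_) S) ≈⟨ (λ k → cong₂ _+_ (cong (λ t → monomial t k) invFirst) (gen-map inv (0 ∷_) S k)) ⟩
  monomial (suc n) +P gen (inv ∘ (0 ∷_)) S                       ≈⟨ (λ k → cong (monomial (suc n) k +_) (gen-congʷ S (All.tabulate (λ {v} _ → cong (_+ inv v) (count-<0 v))) k)) ⟩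
  monomial (suc n) +P shuffleGen 1 n                             ≈⟨ (λ k → cong (monomial (suc n) k +_) (shuffleGen-1 n k)) ⟩
  monomial (suc n) +P qint (suc n)                               ≈⟨ ≈P-sym (qint-suc (suc n)) ⟩
  qint (suc (suc n))                                             ∎
  where
  open ≈P-Reasoning
  S : List (List ℕ)
  S = shuffles (1 ∷ []) (replicate n 0)
  invFirst : inv (1 ∷ 0 ∷ replicate n 0) ≡ suc n
  invFirst = trans (cong₂ _+_ (count-<1-zeros (suc n)) (inv-zeros (suc n))) (+-identityʳ (suc n))

w₀ : ℕ → List ℕ
w₀ zero    = []
w₀ (suc n) = suc n ∷ w₀ n

w₀-length : ∀ n → length (w₀ n) ≡ n
w₀-length zero    = refl
w₀-length (suc n) = cong suc (w₀-length n)

w₀-positive : ∀ n → All (0 <_) (w₀ n)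
w₀-positive zero    = []
w₀-positive (suc n) = s≤s z≤n ∷ w₀-positive n

w₀-bounded : ∀ n → All (_≤ n) (w₀ n)
w₀-bounded zero    = []
w₀-bounded (suc n) = ≤-refl ∷ All.map m≤n⇒m≤1+n (w₀-bounded n)

w₀-skew : ∀ m r → shiftLetters r (w₀ m) ++ w₀ r ≡ w₀ (m + r)
w₀-skew zero    r = refl
w₀-skew (suc m) r = cong₂ _∷_ (trans (+-suc r m) (cong suc (+-comm r m))) (w₀-skew m r)

FΛ-w₀-skew : ∀ m r → FΛ (w₀ (m + r)) ≈P FΛ (w₀ m) *P (FΛ (w₀ r) *P shuffleGen m r)
FΛ-w₀-skew m r = begin
  FΛ (w₀ (m + r))                                         ≡⟨ cong FΛ (sym (w₀-skew m r)) ⟩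
  FΛ (x ++ w₀ r)                                          ≈⟨ SkewSum.FΛ-skewSum x (w₀ r) (All-shiftLetters r (w₀-positive m)) (w₀-bounded r) ⟩
  FΛ x *P (FΛ (w₀ r) *P shuffleGen (length x) (length (w₀ r))) ≈⟨ *P-cong (FΛ-shiftLetters r (w₀ m)) (≈P-refl {FΛ (w₀ r) *P _}) ⟩
  FΛ (w₀ m) *P (FΛ (w₀ r) *P shuffleGen (length x) (length (w₀ r))) ≡⟨ cong₂ (λ p q → FΛ (w₀ m) *P (FΛ (w₀ r) *P shuffleGen p q)) lengthX (w₀-length r) ⟩
  FΛ (w₀ m) *P (FΛ (w₀ r) *P shuffleGen m r)              ∎
  where
  open ≈P-Reasoning
  x : List ℕ
  x = shiftLetters r (w₀ m)
  lengthX : length x ≡ m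
  lengthX = trans (length-map (r +_) (w₀ m)) (w₀-length m)

-- F(Λ_{w₀(n)}) = [n]!, by induction: w₀(n+1) is the skew sum of 1 and w₀(n),
-- and G(1,n) = [n+1].
FΛ-w₀ : ∀ n → FΛ (w₀ n) ≈P qfact n
FΛ-w₀ zero zero    = refl
FΛ-w₀ zero (suc k) = refl
FΛ-w₀ (suc n) = begin
  FΛ (w₀ (1 + n))                                    ≈⟨ FΛ-w₀-skew 1 n ⟩
  FΛ (w₀ 1) *P (FΛ (w₀ n) *P shuffleGen 1 n)         ≈⟨ *P-cong FΛ-w₀-1 (*P-cong (FΛ-w₀ n) (shuffleGen-1 n)) ⟩
  oneP *P (qfact n *P qint (suc n))                  ≈⟨ oneP-*P (qfact n *P qint (suc n)) ⟩
  qfact (suc n)                                      ∎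
  where
  open ≈P-Reasoning
  FΛ-w₀-1 : FΛ (w₀ 1) ≈P oneP
  FΛ-w₀-1 zero    = refl
  FΛ-w₀-1 (suc k) = refl

-- [m+r]! = [m]! [r]! G(m,r), so G(m,r) is the q-binomial coefficient.
qfact-split : ∀ m r → qfact (m + r) ≈P qfact m *P (qfact r *P shuffleGen m r)
qfact-split m r = begin
  qfact (m + r)                                      ≈⟨ ≈P-sym (FΛ-w₀ (m + r)) ⟩
  FΛ (w₀ (m + r))                                    ≈⟨ FΛ-w₀-skew m r ⟩
  FΛ (w₀ m) *P (FΛ (w₀ r) *P shuffleGen m r)         ≈⟨ *P-cong (FΛ-w₀ m) (*P-cong (FΛ-w₀ r) (≈P-refl {shuffleGen m r})) ⟩
  qfact m *P (qfact r *P shuffleGen m r)             ∎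
  where open ≈P-Reasoning

infix 4 _≪_
_≪_ : List ℕ → List ℕ → Set
A ≪ B = All (λ x → All (x <_) B) A

≪-flip : ∀ {A B} → A ≪ B → All (λ y → All (_< y) A) B
≪-flip {[]}    {B} []       = All.tabulate (λ _ → [])
≪-flip {x ∷ A} {B} (p ∷ ps) = All.zipWith (λ (q , qs) → q ∷ qs) (p , ≪-flip ps)

rank : List ℕ → ℕ → ℕ
rank w x = suc (count (_<? x) w)

st-direct : ∀ A B → A ≪ B → st (A ++ B) ≡ st A ++ shiftLetters (length A) (st B)
st-direct A B A≪B = trans (map-++ (rank (A ++ B)) A B)
  (cong₂ _++_ (map-cong-local (All.map rankA A≪B)) (trans (map-cong-local (All.map rankB (≪-flip A≪B))) (map-∘ B)))
  where
  rankA : ∀ {x} → All (x <_) B → rank (A ++ B) x ≡ rank A x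
  rankA {x} x<B = cong suc (trans (count-++ (_<? x) A B)
    (trans (cong (count (_<? x) A +_) (count-none (_<? x) (All.map <⇒≯ x<B))) (+-identityʳ _)))
  rankB : ∀ {y} → All (_< y) A → rank (A ++ B) y ≡ length A + rank B y
  rankB {y} A<y = trans (cong suc (trans (count-++ (_<? y) A B) (cong (_+ count (_<? y) B) (count-all (_<? y) A<y))))
    (sym (+-suc _ _))

st-skew : ∀ A B → B ≪ A → st (A ++ B) ≡ shiftLetters (length B) (st A) ++ st B
st-skew A B B≪A = trans (map-++ (rank (A ++ B)) A B)
  (cong₂ _++_ (trans (map-cong-local (All.map rankA (≪-flip B≪A))) (map-∘ A)) (map-cong-local (All.map rankB B≪A)))
  where
  rankA : ∀ {y} → All (_< y) B → rank (A ++ B) y ≡ length B + rank A y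
  rankA {y} B<y = trans (cong suc (trans (count-++ (_<? y) A B)
    (trans (cong (count (_<? y) A +_) (count-all (_<? y) B<y)) (+-comm _ (length B))))) (sym (+-suc _ _))
  rankB : ∀ {x} → All (x <_) A → rank (A ++ B) x ≡ rank B x
  rankB {x} x<A = cong suc (trans (count-++ (_<? x) A B) (cong (_+ count (_<? x) B) (count-none (_<? x) (All.map <⇒≯ x<A))))

st-positive : ∀ w → All (0 <_) (st w)
st-positive w = All.tabulate λ v∈ → case ∈-map⁻ (rank w) v∈ of λ where (_ , _ , refl) → s≤s z≤n

-- rank w x ≤ |w| for x ∈ w, since x itself is not counted.
st-bounded : ∀ w → All (_≤ length w) (st w)
st-bounded w = All.tabulate λ v∈ → case ∈-map⁻ (rank w) v∈ of λ where
  (x , x∈ , refl) → filter-notAll (_<? x) w (Any.map (λ { refl → <-irrefl refl }) x∈)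

st-length : ∀ w → length (st w) ≡ length w
st-length w = length-map (rank w) w

at-++ˡ : ∀ L X {i} → i < length L → at (L ++ X) i ≡ at L i
at-++ˡ (x ∷ L) X {zero}  _ = refl
at-++ˡ (x ∷ L) X {suc i} p = at-++ˡ L X (≤-pred p)

at-++ʳ : ∀ L X j → at (L ++ X) (length L + j) ≡ at X j
at-++ʳ []      X j = refl
at-++ʳ (x ∷ L) X j = at-++ʳ L X j

at-∈ : ∀ xs {i} → i < length xs → at xs i ∈ xs
at-∈ (x ∷ xs) {zero}  _ = here refl
at-∈ (x ∷ xs) {suc i} p = there (at-∈ xs (≤-pred p))

∈-at : ∀ {x xs} → x ∈ xs → ∃ λ i → i < length xs × at xs i ≡ x
∈-at (here refl) = 0 , s≤s z≤n , refl
∈-at (there m) with ∈-at m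
... | i , p , e = suc i , s≤s p , e

at-take : ∀ m xs {i} → i < m → at (take m xs) i ≡ at xs i
at-take (suc m) []       _ = refl
at-take (suc m) (x ∷ xs) {zero}  _ = refl
at-take (suc m) (x ∷ xs) {suc i} p = at-take m xs (≤-pred p)

at-drop : ∀ m xs j → at (drop m xs) j ≡ at xs (m + j)
at-drop zero    xs       j = refl
at-drop (suc m) []       j = refl
at-drop (suc m) (x ∷ xs) j = at-drop m xs j

at-∈-take : ∀ m xs {i} → i < m → i < length xs → at xs i ∈ take m xs
at-∈-take m xs {i} i<m i<n = subst (_∈ take m xs) (at-take m xs i<m)
  (at-∈ (take m xs) (subst (i <_) (sym (length-take m xs)) (⊓-glb i<m i<n)))

at-∈-drop : ∀ m xs {p} → m ≤ p → p < length xs → at xs p ∈ drop m xs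
at-∈-drop m xs {p} m≤p p<n = subst (_∈ drop m xs) (trans (at-drop m xs (p ∸ m)) (cong (at xs) (m+[n∸m]≡n m≤p)))
  (at-∈ (drop m xs) (subst (p ∸ m <_) (sym (length-drop m xs)) (∸-monoˡ-< p<n m≤p)))

direct-at : ∀ m xs {i p} → take m xs ≪ drop m xs → i < m → m ≤ p → p < length xs → at xs i < at xs p
direct-at m xs split i<m m≤p p<n =
  All.lookup (All.lookup split (at-∈-take m xs i<m (<-≤-trans i<m (≤-trans m≤p (<⇒≤ p<n))))) (at-∈-drop m xs m≤p p<n)

skew-at : ∀ m xs {i p} → drop m xs ≪ take m xs → i < m → m ≤ p → p < length xs → at xs p < at xs i
skew-at m xs split i<m m≤p p<n =
  All.lookup (All.lookup split (at-∈-drop m xs m≤p p<n)) (at-∈-take m xs i<m (<-≤-trans i<m (≤-trans m≤p (<⇒≤ p<n))))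

-- skip ℓ p : position in L ++ M ∷ R of the p-th entry of L ++ R, ℓ = |L|.
skip : ℕ → ℕ → ℕ
skip ℓ p with p <? ℓ
... | yes _ = p
... | no _  = suc p

skip-low : ∀ {ℓ p} → p < ℓ → skip ℓ p ≡ p
skip-low {ℓ} {p} q with p <? ℓ
... | yes _ = refl
... | no ¬q = ⊥-elim (¬q q)

skip-high : ∀ {ℓ p} → ℓ ≤ p → skip ℓ p ≡ suc p
skip-high {ℓ} {p} q with p <? ℓ
... | yes r = ⊥-elim (<⇒≱ r q)
... | no _  = refl

skip-mono : ∀ ℓ {p q} → p < q → skip ℓ p < skip ℓ q
skip-mono ℓ {p} {q} p<q with p <? ℓ | q <? ℓ
... | yes _   | yes _ = p<q
... | yes _   | no _  = m<n⇒m<1+n p<q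
... | no p≮ℓ  | yes q<ℓ = ⊥-elim (p≮ℓ (<-trans p<q q<ℓ))
... | no _    | no _  = s≤s p<q

skip-≤ : ∀ ℓ p → skip ℓ p ≤ suc p
skip-≤ ℓ p with p <? ℓ
... | yes _ = n≤1+n p
... | no _  = ≤-refl

length-insert : ∀ L (M : ℕ) R → length (L ++ M ∷ R) ≡ suc (length (L ++ R))
length-insert []      M R = refl
length-insert (x ∷ L) M R = cong suc (length-insert L M R)

at-insert : ∀ L (M : ℕ) R → at (L ++ M ∷ R) (length L) ≡ M
at-insert []      M R = refl
at-insert (x ∷ L) M R = at-insert L M R

at-skip : ∀ L (M : ℕ) R p → at (L ++ M ∷ R) (skip (length L) p) ≡ at (L ++ R) p
at-skip L M R p with p <? length L
... | yes p<ℓ = trans (at-++ˡ L (M ∷ R) p<ℓ) (sym (at-++ˡ L R p<ℓ))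
... | no p≮ℓ = begin
  at (L ++ M ∷ R) (suc p)                  ≡⟨ cong (λ t → at (L ++ M ∷ R) (suc t)) (sym ℓ+d≡p) ⟩
  at (L ++ M ∷ R) (suc (length L + d))     ≡⟨ cong (at (L ++ M ∷ R)) (sym (+-suc (length L) d)) ⟩
  at (L ++ M ∷ R) (length L + suc d)       ≡⟨ at-++ʳ L (M ∷ R) (suc d) ⟩
  at R d                                   ≡⟨ sym (at-++ʳ L R d) ⟩
  at (L ++ R) (length L + d)               ≡⟨ cong (at (L ++ R)) ℓ+d≡p ⟩
  at (L ++ R) p                            ∎
  where
  open ≡-Reasoning
  d : ℕ
  d = p ∸ length L
  ℓ+d≡p : length L + d ≡ p
  ℓ+d≡p = m+[n∸m]≡n (≮⇒≥ p≮ℓ)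

Pattern : ℕ → ℕ → ℕ → ℕ → Set
Pattern a b c d = (b < d × d < a × a < c) ⊎ (c < a × a < d × d < b)

no-occurrence : ∀ π → Separable π → ∀ {i j k h a b c d} → i < j → j < k → k < h → h < length π →
  at π i ≡ a → at π j ≡ b → at π k ≡ c → at π h ≡ d → ¬ Pattern a b c d
no-occurrence π sep i<j j<k k<h h<n refl refl refl refl pat = sep (_ , _ , _ , _ , i<j , j<k , k<h , h<n , pat)

separable-delete : ∀ L M R → Separable (L ++ M ∷ R) → Separable (L ++ R)
separable-delete L M R sep (i , j , k , h , i<j , j<k , k<h , h<n , pat) =
  no-occurrence (L ++ M ∷ R) sep (skip-mono ℓ i<j) (skip-mono ℓ j<k) (skip-mono ℓ k<h)
    (subst (skip ℓ h <_) (sym (length-insert L M R)) (s≤s (≤-trans (skip-≤ ℓ h) h<n)))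
    (at-skip L M R i) (at-skip L M R j) (at-skip L M R k) (at-skip L M R h) pat
  where
  ℓ : ℕ
  ℓ = length L

unique-↭ : ∀ {xs ys : List ℕ} → xs ↭ ys → Unique xs → Unique ys
unique-↭ p = Unique-resp-↭ (↭⇒↭ₛ p)

distinct-across : ∀ (A B : List ℕ) {a c} → Unique (A ++ B) → a ∈ A → c ∈ B → a ≢ c
distinct-across (x ∷ A) B (x∉ ∷ _) (here refl) c∈ = All.lookup (++⁻ʳ A x∉) c∈
distinct-across (x ∷ A) B (_ ∷ u)  (there a∈)  c∈ = distinct-across A B u a∈ c∈

_≪?_ : ∀ A B → Dec (A ≪ B)
A ≪? B = All.all? (λ x → All.all? (x <?_) B) A

crossing : ∀ A B → Unique (A ++ B) → ¬ A ≪ B →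
  ∃₂ λ i t → i < length A × t < length B × at B t < at A i
crossing A B distinct A≪̸B with find (¬All⇒Any¬ (λ x → All.all? (x <?_) B) A A≪̸B)
... | a , a∈ , a≪̸B with find (¬All⇒Any¬ (a <?_) B a≪̸B) | ∈-at a∈
...   | c , c∈ , a≮c | i , i<|A| , refl with ∈-at c∈
...     | t , t<|B| , refl = i , t , i<|A| , t<|B| ,
            ≤∧≢⇒< (≮⇒≥ a≮c) (distinct-across A B distinct a∈ c∈ ∘ sym)

SplitAt : List ℕ → ℕ → Set
SplitAt π m = (take m π ≪ drop m π) ⊎ (drop m π ≪ take m π)

Decomposable : List ℕ → Set
Decomposable π = ∃ λ m → 1 ≤ m × m < length π × SplitAt π m

-- Re-inserting the maximal letter M into a decomposable π′ = L ++ R gives a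
-- decomposable π = L ++ M ∷ R: a split of π′ either survives, or moves to
-- one side of M, or would produce a 2413 / 3142 occurrence through M.
module InsertMax (L : List ℕ) (M : ℕ) (R : List ℕ) (sep : Separable (L ++ M ∷ R))
                 (below : All (_< M) (L ++ R)) (distinct : Unique (L ++ R)) where

  π π′ : List ℕ
  π  = L ++ M ∷ R
  π′ = L ++ R

  ℓ n′ : ℕ
  ℓ  = length L
  n′ = length π′

  n′≡ : n′ ≡ ℓ + length R
  n′≡ = length-++ L

  left-of-M : ∀ {p} → p < ℓ → skip ℓ p < ℓ
  left-of-M p<ℓ = subst (_< ℓ) (sym (skip-low p<ℓ)) p<ℓ

  in-π : ∀ {p} → p < n′ → skip ℓ p < length π
  in-π p<n′ = subst (_ <_) (sym (length-insert L M R)) (≤-<-trans (skip-≤ ℓ _) (s≤s p<n′))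

  right-of-M : ∀ t → ℓ < skip ℓ (ℓ + t)
  right-of-M t = subst (ℓ <_) (sym (skip-high (m≤m+n ℓ t))) (s≤s (m≤m+n ℓ t))

  at-right : ∀ {t} → t < length R → ℓ + t < n′
  at-right t<r = subst (_ <_) (sym n′≡) (+-monoʳ-< ℓ t<r)

  direct-left : ∀ {m} → m ≤ ℓ → take m π′ ≪ drop m π′ → take m π ≪ drop m π
  direct-left {m} m≤ℓ split = subst₂ _≪_ (sym (take-++-≤ L (M ∷ R) m≤ℓ)) (sym (drop-++-≤ L (M ∷ R) m≤ℓ))
    (All.zipWith (λ (x<rest , x<M) → All-resp-↭ (↭-sym (↭-shift M (drop m L) R)) (x<M ∷ x<rest))
      (subst₂ _≪_ (take-++-≤ L R m≤ℓ) (drop-++-≤ L R m≤ℓ) split , take⁺ m (++⁻ˡ L below)))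

  skew-right : ∀ {m} → ℓ ≤ m → drop m π′ ≪ take m π′ → drop (suc m) π ≪ take (suc m) π
  skew-right {m} ℓ≤m split = subst (λ p → drop p π ≪ take p π) (trans (+-suc ℓ d) (cong suc ℓ+d≡m))
    (subst₂ _≪_ (sym (drop-++-+ L (M ∷ R) (suc d))) (sym (take-++-+ L (M ∷ R) (suc d)))
      (All.zipWith (λ (y<rest , y<M) → All-resp-↭ (↭-sym (↭-shift M L (take d R))) (y<M ∷ y<rest))
        (subst₂ _≪_ (drop-++-+ L R d) (take-++-+ L R d) (subst (λ p → drop p π′ ≪ take p π′) (sym ℓ+d≡m) split) ,
         drop⁺ d (++⁻ʳ L below))))
    where
    d : ℕ
    d = m ∸ ℓ
    ℓ+d≡m : ℓ + d ≡ m
    ℓ+d≡m = m+[n∸m]≡n ℓ≤m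

  -- A direct split of π′ strictly inside R forces L ≪ R: otherwise entries
  -- a ∈ L, M, c ∈ R, y = π′ₘ form a 2413.
  no-2413 : ∀ {m} → ℓ < m → m < n′ → take m π′ ≪ drop m π′ → ¬ ¬ (L ≪ R)
  no-2413 {m} ℓ<m m<n′ split L≪̸R with crossing L R distinct L≪̸R
  ... | i , t , i<ℓ , t<r , c<a =
    no-occurrence π sep (left-of-M i<ℓ) (right-of-M t) (skip-mono ℓ c-before-y) (in-π m<n′)
      at-a (at-insert L M R) at-c (at-skip L M R m) (inj₂ (c<a , a<y , y<M))
    where
    at-a : at π (skip ℓ i) ≡ at L i
    at-a = trans (at-skip L M R i) (at-++ˡ L R i<ℓ)
    at-c : at π (skip ℓ (ℓ + t)) ≡ at R t
    at-c = trans (at-skip L M R (ℓ + t)) (at-++ʳ L R t)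
    a<y : at L i < at π′ m
    a<y = subst (_< _) (at-++ˡ L R i<ℓ) (direct-at m π′ split (<-trans i<ℓ ℓ<m) ≤-refl m<n′)
    y<M : at π′ m < M
    y<M = All.lookup below (at-∈ π′ m<n′)
    c-before-y : ℓ + t < m
    c-before-y with ℓ + t <? m
    ... | yes p = p
    ... | no p  = ⊥-elim (<-asym c<a (subst₂ _<_ (at-++ˡ L R i<ℓ) (at-++ʳ L R t)
                    (direct-at m π′ split (<-trans i<ℓ ℓ<m) (≮⇒≥ p) (at-right t<r))))

  -- Symmetrically, a skew split of π′ strictly inside L forces R ≪ L:
  -- otherwise y = π′₀, c ∈ L, M, a ∈ R form a 3142.
  no-3142 : ∀ {m} → 1 ≤ m → m < ℓ → drop m π′ ≪ take m π′ → ¬ ¬ (R ≪ L)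
  no-3142 {m} 1≤m m<ℓ split R≪̸L with crossing R L (unique-↭ (↭-++-comm L R) distinct) R≪̸L
  ... | t , j , t<r , j<ℓ , c<a =
    no-occurrence π sep (skip-mono ℓ (<-≤-trans 1≤m m≤j)) (left-of-M j<ℓ) (right-of-M t) (in-π (at-right t<r))
      (at-skip L M R 0) at-c (at-insert L M R) at-a (inj₁ (c<a , a<y , y<M))
    where
    m≤ℓ+t : m ≤ ℓ + t
    m≤ℓ+t = ≤-trans (<⇒≤ m<ℓ) (m≤m+n ℓ t)
    at-c : at π (skip ℓ j) ≡ at L j
    at-c = trans (at-skip L M R j) (at-++ˡ L R j<ℓ)
    at-a : at π (skip ℓ (ℓ + t)) ≡ at R t
    at-a = trans (at-skip L M R (ℓ + t)) (at-++ʳ L R t)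
    a<y : at R t < at π′ 0
    a<y = subst (_< _) (at-++ʳ L R t) (skew-at m π′ split 1≤m m≤ℓ+t (at-right t<r))
    y<M : at π′ 0 < M
    y<M = All.lookup below (at-∈ π′ (≤-<-trans z≤n (at-right t<r)))
    m≤j : m ≤ j
    m≤j with j <? m
    ... | yes j<m = ⊥-elim (<-asym c<a (subst₂ _<_ (at-++ʳ L R t) (at-++ˡ L R j<ℓ)
                      (skew-at m π′ split j<m m≤ℓ+t (at-right t<r))))
    ... | no j≮m  = ≮⇒≥ j≮m

  ℓ<n′ : 1 ≤ length R → ℓ < n′
  ℓ<n′ 1≤r = subst (_< n′) (+-identityʳ ℓ) (at-right 1≤r)

  below-length-π : ∀ {p} → p < n′ → suc p < length π
  below-length-π p<n′ = subst (_ <_) (sym (length-insert L M R)) (s≤s p<n′)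

  lift : 1 ≤ ℓ → 1 ≤ length R → Decomposable π′ → Decomposable π
  lift 1≤ℓ 1≤r (m , 1≤m , m<n′ , inj₁ split) with m ≤? ℓ
  ... | yes m≤ℓ = m , 1≤m , <-trans (n<1+n m) (below-length-π m<n′) , inj₁ (direct-left m≤ℓ split)
  ... | no m≰ℓ with L ≪? R
  ...   | yes L≪R = ℓ , 1≤ℓ , <-trans (n<1+n ℓ) (below-length-π (ℓ<n′ 1≤r)) ,
                    inj₁ (direct-left ≤-refl (subst₂ _≪_ (sym (take-++-length L R)) (sym (drop-++-length L R)) L≪R))
  ...   | no L≪̸R = ⊥-elim (no-2413 (≰⇒> m≰ℓ) m<n′ split L≪̸R)
  lift 1≤ℓ 1≤r (m , 1≤m , m<n′ , inj₂ split) with ℓ ≤? m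
  ... | yes ℓ≤m = suc m , s≤s z≤n , below-length-π m<n′ , inj₂ (skew-right ℓ≤m split)
  ... | no ℓ≰m with R ≪? L
  ...   | yes R≪L = suc ℓ , s≤s z≤n , below-length-π (ℓ<n′ 1≤r) ,
                    inj₂ (skew-right ≤-refl (subst₂ _≪_ (sym (drop-++-length L R)) (sym (take-++-length L R)) R≪L))
  ...   | no R≪̸L = ⊥-elim (no-3142 1≤m (≰⇒> ℓ≰m) split R≪̸L)

maxLetter : ∀ x xs → ∃ λ M → M ∈ x ∷ xs × All (_≤ M) (x ∷ xs)
maxLetter x xs = max x xs , Sum.[ here , there ]′ (argmax-sel id x xs) , ⊥≤max x xs ∷ xs≤max x xs

remove-max : ∀ L M R → Unique (L ++ M ∷ R) → All (_≤ M) (L ++ M ∷ R) → Unique (L ++ R) × All (_< M) (L ++ R)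
remove-max L M R distinct ≤M with unique-↭ (↭-shift M L R) distinct | All-resp-↭ (↭-shift M L R) ≤M
... | M∉ ∷ distinct′ | _ ∷ ≤M′ = distinct′ , All.zipWith (λ (z≤M , M≢z) → ≤∧≢⇒< z≤M (M≢z ∘ sym)) (≤M′ , M∉)

-- Every separable word of distinct letters of length ≥ 2 splits as a direct
-- or a skew sum; by induction on the length, deleting the maximal letter.
mutual
  decompose : ∀ n π → length π ≡ n → 2 ≤ n → Unique π → Separable π → Decomposable π
  decompose (suc n) (x ∷ xs) len 2≤ distinct sep with maxLetter x xs
  ... | M , M∈ , ≤M with ∈-∃++ M∈
  ... | L , R , eq = subst Decomposable (sym eq)
          (aroundMax n L M R (trans (cong length (sym eq)) len) 2≤ (subst Unique eq distinct) (subst Separable eq sep) (subst (All (_≤ M)) eq ≤M))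

  aroundMax : ∀ n L M R → length (L ++ M ∷ R) ≡ suc n → 2 ≤ suc n → Unique (L ++ M ∷ R) →
    Separable (L ++ M ∷ R) → All (_≤ M) (L ++ M ∷ R) → Decomposable (L ++ M ∷ R)
  -- M first: skew split after M.
  aroundMax n [] M R len 2≤ distinct sep ≤M =
    1 , ≤-refl , subst (1 <_) (sym len) 2≤ , inj₂ (All.map (_∷ []) (proj₂ (remove-max [] M R distinct ≤M)))
  -- M last: direct split before M.
  aroundMax n L@(_ ∷ _) M [] len 2≤ distinct sep ≤M =
    length L , s≤s z≤n , subst (length L <_) (sym (length-insert L M [])) (s≤s (≤-reflexive (cong length (sym (++-identityʳ L))))) ,
    inj₁ (subst₂ _≪_ (sym (take-++-length L (M ∷ []))) (sym (drop-++-length L (M ∷ [])))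
           (All.map (_∷ []) (subst (All (_< M)) (++-identityʳ L) (proj₂ (remove-max L M [] distinct ≤M)))))
  -- M inside: decompose L ++ R and re-insert M.
  aroundMax n L@(_ ∷ _) M R@(_ ∷ _) len 2≤ distinct sep ≤M with remove-max L M R distinct ≤M
  ... | distinct′ , below = InsertMax.lift L M R sep below distinct′ (s≤s z≤n) (s≤s z≤n)
                              (decompose n (L ++ R) length′ 2≤n distinct′ (separable-delete L M R sep))
    where
    length′ : length (L ++ R) ≡ n
    length′ = suc-injective (trans (sym (length-insert L M R)) len)
    2≤n : 2 ≤ n
    2≤n = subst (2 ≤_) (trans (sym (length-++ L)) length′) (+-mono-≤ (s≤s z≤n) (s≤s z≤n))

F-direct : ∀ A B → A ≪ B → F (A ++ B) ≈P F A *P F B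
F-direct A B A≪B = begin
  FΛ (st (A ++ B))                                  ≡⟨ cong FΛ (st-direct A B A≪B) ⟩
  FΛ (st A ++ shiftLetters (length A) (st B))       ≈⟨ DirectSum.FΛ-directSum (st A) _ (st-bounded A) (All-shiftLetters (length A) (st-positive B)) ⟩
  F A *P FΛ (shiftLetters (length A) (st B))        ≈⟨ *P-cong (≈P-refl {F A}) (FΛ-shiftLetters (length A) (st B)) ⟩
  F A *P F B                                        ∎
  where open ≈P-Reasoning

F-skew : ∀ A B → B ≪ A → F (A ++ B) ≈P F A *P (F B *P shuffleGen (length A) (length B))
F-skew A B B≪A = begin
  FΛ (st (A ++ B))                                  ≡⟨ cong FΛ (st-skew A B B≪A) ⟩
  FΛ (x ++ st B)                                    ≈⟨ SkewSum.FΛ-skewSum x (st B) (All-shiftLetters (length B) (st-positive A)) (st-bounded B) ⟩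
  FΛ x *P (F B *P shuffleGen (length x) (length (st B))) ≈⟨ *P-cong (FΛ-shiftLetters (length B) (st A)) (≈P-refl {F B *P _}) ⟩
  F A *P (F B *P shuffleGen (length x) (length (st B))) ≡⟨ cong₂ (λ p r → F A *P (F B *P shuffleGen p r)) length-x (st-length B) ⟩
  F A *P (F B *P shuffleGen (length A) (length B))  ∎
  where
  open ≈P-Reasoning
  x : List ℕ
  x = shiftLetters (length B) (st A)
  length-x : length x ≡ length A
  length-x = trans (length-map (length B +_) (st A)) (st-length A)

-- Clearing the common factor G between F(π) = F_A F_B G and [m+r]! = [m]! [r]! G.
cancel-G : ∀ a b g c d → (a *P (b *P g)) *P (c *P d) ≈P (c *P (d *P g)) *P (a *P b)
cancel-G a b g c d = begin
  (a *P (b *P g)) *P (c *P d)     ≈⟨ *P-cong (pull a b) (≈P-refl {c *P d}) ⟩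
  (g *P (a *P b)) *P (c *P d)     ≈⟨ *P-assoc g (a *P b) (c *P d) ⟩
  g *P ((a *P b) *P (c *P d))     ≈⟨ *P-cong (≈P-refl {g}) (*P-comm (a *P b) (c *P d)) ⟩
  g *P ((c *P d) *P (a *P b))     ≈⟨ ≈P-sym (*P-assoc g (c *P d) (a *P b)) ⟩
  (g *P (c *P d)) *P (a *P b)     ≈⟨ *P-cong (≈P-sym (pull c d)) (≈P-refl {a *P b}) ⟩
  (c *P (d *P g)) *P (a *P b)     ∎
  where
  open ≈P-Reasoning
  pull : ∀ x y → x *P (y *P g) ≈P g *P (x *P y)
  pull x y = ≈P-trans (≈P-sym (*P-assoc x y g)) (*P-comm (x *P y) g)

F-split-direct : ∀ π m → take m π ≪ drop m π → F π ≈P F (take m π) *P F (drop m π)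
F-split-direct π m split = subst (λ w → F w ≈P F (take m π) *P F (drop m π)) (take++drop≡id m π) (F-direct (take m π) (drop m π) split)

F-split-skew : ∀ π m → m ≤ length π → drop m π ≪ take m π →
  F π *P (qfact m *P qfact (length π ∸ m)) ≈P qfact (length π) *P (F (take m π) *P F (drop m π))
F-split-skew π m m≤n split = begin
  F π *P (qfact m *P qfact r)                 ≡⟨ cong (λ w → F w *P (qfact m *P qfact r)) (sym (take++drop≡id m π)) ⟩
  F (A ++ B) *P (qfact m *P qfact r)          ≈⟨ *P-cong (F-skew A B split) (≈P-refl {qfact m *P qfact r}) ⟩
  (F A *P (F B *P shuffleGen (length A) (length B))) *P (qfact m *P qfact r)
                                              ≡⟨ cong₂ (λ p s → (F A *P (F B *P shuffleGen p s)) *P (qfact m *P qfact r)) |A|≡m (length-drop m π) ⟩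
  (F A *P (F B *P shuffleGen m r)) *P (qfact m *P qfact r) ≈⟨ cancel-G (F A) (F B) (shuffleGen m r) (qfact m) (qfact r) ⟩
  (qfact m *P (qfact r *P shuffleGen m r)) *P (F A *P F B) ≈⟨ *P-cong (≈P-sym (qfact-split m r)) (≈P-refl {F A *P F B}) ⟩
  qfact (m + r) *P (F A *P F B)               ≡⟨ cong (λ p → qfact p *P (F A *P F B)) (m+[n∸m]≡n m≤n) ⟩
  qfact (length π) *P (F A *P F B)            ∎
  where
  open ≈P-Reasoning
  A B : List ℕ
  A = take m π
  B = drop m π
  r : ℕ
  r = length π ∸ m
  |A|≡m : length A ≡ m
  |A|≡m = trans (length-take m π) (m≤n⇒m⊓n≡m m≤n)

perm-length : ∀ {n π} → IsPerm n π → length π ≡ n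
perm-length {n} perm = trans (↭-length perm) (length-applyUpTo suc n)

perm-unique : ∀ {n π} → IsPerm n π → Unique π
perm-unique {n} perm = unique-↭ (↭-sym perm) (UP.applyUpTo⁺₁ suc n (λ i<j _ → <⇒≢ i<j ∘ suc-injective))

split-direct : ∀ π m {p} → 1 ≤ m → m ≤ p → p < length π → SplitAt π m → at π 0 < at π p → take m π ≪ drop m π
split-direct π m 1≤m m≤p p<n (inj₁ direct) _     = direct
split-direct π m 1≤m m≤p p<n (inj₂ skew)   first<p = ⊥-elim (<-asym first<p (skew-at m π skew 1≤m m≤p p<n))

split-skew : ∀ π m {p} → 1 ≤ m → m ≤ p → p < length π → SplitAt π m → at π 0 > at π p → drop m π ≪ take m π
split-skew π m 1≤m m≤p p<n (inj₂ skew)   _       = skew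
split-skew π m 1≤m m≤p p<n (inj₁ direct) first>p = ⊥-elim (<-asym first>p (direct-at m π direct 1≤m m≤p p<n))

proposition2p4 : (n : ℕ) (π : List ℕ) → 2 ≤ n → IsPerm n π → Separable π →
    (at π 0 < at π (n ∸ 1) →
    ∃ λ m → 1 ≤ m × m < n ×
    F π ≈P F (take m π) *P F (drop m π))
    × (at π 0 > at π (n ∸ 1) →
    ∃ λ m → 1 ≤ m × m < n ×
    F π *P (qfact m *P qfact (n ∸ m)) ≈P qfact n *P (F (take m π) *P F (drop m π)))
proposition2p4 (suc n) π 2≤ perm sep with decompose (suc n) π (perm-length perm) 2≤ (perm-unique perm) sep
... | m , 1≤m , m<|π| , split =
  (λ first<last → m , 1≤m , m<n , F-split-direct π m (split-direct π m 1≤m m≤n last split first<last)) ,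
  (λ first>last → m , 1≤m , m<n ,
     subst (λ N → F π *P (qfact m *P qfact (N ∸ m)) ≈P qfact N *P (F (take m π) *P F (drop m π))) (perm-length perm)
           (F-split-skew π m (<⇒≤ m<|π|) (split-skew π m 1≤m m≤n last split first>last)))
  where
  m<n : m < suc n
  m<n = subst (m <_) (perm-length perm) m<|π|
  m≤n : m ≤ n
  m≤n = ≤-pred m<n
  last : n < length π
  last = subst (n <_) (sym (perm-length perm)) ≤-refl
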